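{- Let $G$ be a simple 3-connected cubic claw-free graph not isomorphic to $K_4$ or $\overline{C_6}$. Then the set of removable edges of $G$ is exactly the set of edges of $G$ that lie in a triangle. Consequently, $G$ has exactly $|V(G)|$ removable edges.
   Context: Claw-free: no induced $K_{1,3}$. $\overline{C_6}$ is the complement of the 6-cycle (the triangular prism). A graph is matching covered if it is connected, has at least two vertices, and every edge lies in a perfect matching (every 3-connected cubic graph is matching covered). An edge $e$ of a matching covered graph $G$ is removable if $G-e$ is matching covered. -}

module Defs where

open import Data.Nat using (ℕ; _<_; _≤_; suc; _%_; _≡ᵇ_)
open import Data.Fin using (Fin; toℕ; _≟_)
import Data.Fin as F
open import Data.Bool using (Bool; true; false; _∧_; _∨_; not)
open import Data.List using (List; length)
open import Data.List.Membership.Propositional using (_∈_; _∉_)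
open import Data.Product using (Σ; _×_; _,_; ∃)
open import Data.Unit using (⊤)
open import Relation.Nullary using (¬_)
open import Relation.Nullary.Decidable using (⌊_⌋)
open import Relation.Binary.PropositionalEquality using (_≡_; _≢_)
open import Function.Definitions using (Bijective)

record Graph : Set where
  constructor mkGraph
  field
    n   : ℕ
    adj : Fin n → Fin n → Bool

open Graph public

V : Graph → Set
V G = Fin (n G)

Edge : (G : Graph) → V G → V G → Set
Edge G u v = adj G u v ≡ true

Simple : Graph → Set
Simple G = (∀ u v → adj G u v ≡ adj G v u) × (∀ v → adj G v v ≡ false)

count : ∀ {k} → (Fin k → Bool) → ℕ
count {ℕ.zero} p = 0
count {suc k} p with p F.zero
... | true  = suc (count (λ i → p (F.suc i)))
... | false = count (λ i → p (F.suc i))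

degree : (G : Graph) → V G → ℕ
degree G u = count (adj G u)

Cubic : Graph → Set
Cubic G = ∀ v → degree G v ≡ 3

data WalkIn (G : Graph) (P : V G → Set) : V G → V G → Set where
  here : ∀ {u} → P u → WalkIn G P u u
  step : ∀ {u w v} → P u → Edge G u w → WalkIn G P w v → WalkIn G P u v

Connected : Graph → Set
Connected G = ∀ u v → WalkIn G (λ _ → ⊤) u v

KConnected : ℕ → Graph → Set
KConnected k G =
  k < n G ×
  (∀ (S : List (V G)) → length S < k →
     ∀ u v → u ∉ S → v ∉ S → WalkIn G (λ x → x ∉ S) u v)

ClawFree : Graph → Set
ClawFree G = ¬ (Σ (V G) λ c → Σ (V G) λ a → Σ (V G) λ b → Σ (V G) λ d →
  Edge G c a × Edge G c b × Edge G c d ×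
  a ≢ b × a ≢ d × b ≢ d ×
  adj G a b ≡ false × adj G a d ≡ false × adj G b d ≡ false)

Isomorphic : Graph → Graph → Set
Isomorphic G H = Σ (V G → V H) λ f → Bijective _≡_ _≡_ f ×
  (∀ u v → adj G u v ≡ adj H (f u) (f v))

K4 : Graph
K4 = mkGraph 4 (λ u v → not ⌊ u ≟ v ⌋)

-- the 6-cycle 0-1-2-3-4-5-0 and its complement (triangular prism)
C6adj : Fin 6 → Fin 6 → Bool
C6adj u v = (suc (toℕ u) % 6 ≡ᵇ toℕ v) ∨ (suc (toℕ v) % 6 ≡ᵇ toℕ u)

C6bar : Graph
C6bar = mkGraph 6 (λ u v → not ⌊ u ≟ v ⌋ ∧ not (C6adj u v))

-- perfect matching as a "mate" function: each vertex is matched to an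
-- adjacent vertex, and matching is an involution
IsPerfectMatching : (G : Graph) → (V G → V G) → Set
IsPerfectMatching G mate = (∀ v → Edge G v (mate v)) × (∀ v → mate (mate v) ≡ v)

EdgeInPerfectMatching : (G : Graph) → V G → V G → Set
EdgeInPerfectMatching G u v =
  Σ (V G → V G) λ mate → IsPerfectMatching G mate × mate u ≡ v

MatchingCovered : Graph → Set
MatchingCovered G = Connected G × 2 ≤ n G ×
  (∀ u v → Edge G u v → EdgeInPerfectMatching G u v)

deleteEdge : (G : Graph) → V G → V G → Graph
deleteEdge G u v = mkGraph (n G) (λ x y → adj G x y ∧
  not ((⌊ x ≟ u ⌋ ∧ ⌊ y ≟ v ⌋) ∨ (⌊ x ≟ v ⌋ ∧ ⌊ y ≟ u ⌋)))

Removable : (G : Graph) → V G → V G → Set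
Removable G u v = Edge G u v × MatchingCovered (deleteEdge G u v)

InTriangle : (G : Graph) → V G → V G → Set
InTriangle G u v = Edge G u v × Σ (V G) λ w → Edge G u w × Edge G v w

-- Claw-freeness, 3-connectivity and G ≇ K4 put every vertex into exactly one triangle, so the
-- remaining edges form a perfect matching v ↦ outer v. Deleting an outer edge u (outer u) forces
-- u to be matched inside its triangle, so the opposite triangle edge lies in no perfect matching.
-- Conversely, if ab is a triangle edge, each edge pq of G − ab lies in a perfect matching avoiding
-- ab: outer edges in the outer matching, and a triangle edge xy in the outer matching switched
-- along an alternating cycle x y (outer y) … (outer x) x. Such a cycle comes from a walk from
-- outer x to outer y (3-connectivity) avoiding a chosen vertex β ∈ {a, b}; breadth-first search
-- over the triangles makes it simple. The choice of β fails only if two triangles are joined by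
-- two outer edges, and then G is the prism C̄6 or has a 2-cut. Finally each triangle edge is
-- named by the vertex opposite to it, so there are |V(G)| removable edges.

module Submission where

open import Defs
open import Data.Bool as Bool using (Bool; true; false; _∧_; _∨_; not)
open import Data.Bool.Properties using (∧-identityʳ; not-¬; ¬-not; ⇔→≡)
open import Data.Empty using (⊥; ⊥-elim)
open import Data.Fin using (Fin; zero; suc; _≟_; _<_; #_)
open import Data.Fin.Properties using (all?; any?; <-cmp; <-asym; <⇒≢)
open import Data.List using (List; []; _∷_; length; tabulate)
open import Data.List.Properties using (length-tabulate)
open import Data.List.Membership.Propositional using (_∈_; _∉_)
open import Data.List.Membership.Propositional.Properties using (∈-tabulate⁺; ∈-tabulate⁻)
import Data.List.Membership.DecPropositional as DecMembership
open import Data.List.Relation.Unary.All as All using (All; []; _∷_)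
open import Data.List.Relation.Unary.All.Properties using () renaming (tabulate⁺ to All-tabulate⁺)
open import Data.List.Relation.Unary.Any using (here; there)
open import Data.List.Relation.Unary.Unique.Propositional using (Unique)
open import Data.List.Relation.Unary.Unique.Propositional.Properties using () renaming (tabulate⁺ to Unique-tabulate⁺)
open import Data.Nat as ℕ using (ℕ; zero; suc; z≤n; s≤s)
open import Data.Nat.Properties using (suc-injective; ≤-trans; ≤-refl; n≤1+n; <⇒≤)
open import Data.Product using (Σ; _×_; _,_; proj₁; proj₂)
open import Data.Product.Properties using () renaming (≡-dec to ×-≡-dec)
open import Data.Sum using (_⊎_; inj₁; inj₂; [_,_]′)
open import Data.Unit using (⊤; tt)
open import Data.Vec using (Vec; []; _∷_; lookup)
open import Data.Vec.Relation.Unary.All using ([]; _∷_)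
open import Data.Vec.Relation.Unary.AllPairs using ([]; _∷_)
open import Data.Vec.Relation.Unary.Unique.Propositional using () renaming (Unique to Distinct)
open import Data.Vec.Relation.Unary.Unique.Propositional.Properties using (lookup-injective)
open import Function.Bundles using (_⇔_; mk⇔; Equivalence)
open import Relation.Binary.Definitions using (DecidableEquality; tri<; tri≈; tri>)
open import Relation.Binary.PropositionalEquality
open import Relation.Nullary using (¬_; Dec; yes; no)
open import Relation.Nullary.Decidable using (⌊_⌋; toWitness; _→-dec_; _⊎-dec_; _×-dec_; ¬?)

count-cong : ∀ {k} {p q : Fin k → Bool} → (∀ i → p i ≡ q i) → count p ≡ count q
count-cong {zero} eq = refl
count-cong {suc k} {p} {q} eq with p zero | q zero | eq zero
... | true  | true  | _ = cong suc (count-cong (λ i → eq (suc i)))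
... | false | false | _ = count-cong (λ i → eq (suc i))

count≡0⇒false : ∀ {k} (p : Fin k → Bool) → count p ≡ 0 → ∀ i → p i ≡ false
count≡0⇒false {suc k} p eq i with p zero in p0
count≡0⇒false {suc k} p eq zero    | false = p0
count≡0⇒false {suc k} p eq (suc i) | false = count≡0⇒false (λ j → p (suc j)) eq i

count≡suc⇒witness : ∀ {k} (p : Fin k → Bool) {m} → count p ≡ suc m → Σ (Fin k) λ i → p i ≡ true
count≡suc⇒witness {suc k} p eq with p zero in p0
... | true  = zero , p0
... | false with count≡suc⇒witness (λ j → p (suc j)) eq
...   | i , pi = suc i , pi

remove : ∀ {k} → (Fin k → Bool) → Fin k → (Fin k → Bool)
remove p i j = p j ∧ not ⌊ j ≟ i ⌋

⌊suc≟suc⌋ : ∀ {k} (j i : Fin k) → ⌊ suc j ≟ suc i ⌋ ≡ ⌊ j ≟ i ⌋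
⌊suc≟suc⌋ j i with j ≟ i
... | yes _ = refl
... | no _  = refl

remove-suc : ∀ {k} (p : Fin (suc k) → Bool) i j → remove p (suc i) (suc j) ≡ remove (λ j → p (suc j)) i j
remove-suc p i j = cong (λ b → p (suc j) ∧ not b) (⌊suc≟suc⌋ j i)

count-remove : ∀ {k} (p : Fin k → Bool) i → p i ≡ true → count p ≡ suc (count (remove p i))
count-remove {suc k} p zero pi with p zero
... | true = cong suc (count-cong (λ j → sym (∧-identityʳ (p (suc j)))))
count-remove {suc k} p (suc i) pi with p zero
... | true  = cong suc (trans (count-remove (λ j → p (suc j)) i pi) (cong suc (sym (count-cong (remove-suc p i)))))
... | false = trans (count-remove (λ j → p (suc j)) i pi) (cong suc (sym (count-cong (remove-suc p i))))

remove-true : ∀ {k} (p : Fin k → Bool) {i j} → remove p i j ≡ true → p j ≡ true × j ≢ i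
remove-true p {i} {j} r with p j | j ≟ i
... | true | no j≢i = refl , j≢i

remove-keeps : ∀ {k} (p : Fin k → Bool) {i j} → p j ≡ true → j ≢ i → remove p i j ≡ true
remove-keeps p {i} {j} pj j≢i with p j | j ≟ i
... | true | yes j≡i = ⊥-elim (j≢i j≡i)
... | true | no _    = refl

count≡suc⇒peel : ∀ {k} (p : Fin k → Bool) {m} → count p ≡ suc m →
  Σ (Fin k) λ i → p i ≡ true × count (remove p i) ≡ m
count≡suc⇒peel p c with count≡suc⇒witness p c
... | i , pi = i , pi , suc-injective (trans (sym (count-remove p i pi)) c)

In₂ : ∀ {A : Set} → A → A → A → Set
In₂ x a b = x ≡ a ⊎ x ≡ b

In₃ : ∀ {A : Set} → A → A → A → A → Set
In₃ x a b c = x ≡ a ⊎ x ≡ b ⊎ x ≡ c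

record ExactlyThree {k} (p : Fin k → Bool) : Set where
  field
    a b c    : Fin k
    pa       : p a ≡ true
    pb       : p b ≡ true
    pc       : p c ≡ true
    a≢b      : a ≢ b
    a≢c      : a ≢ c
    b≢c      : b ≢ c
    complete : ∀ w → p w ≡ true → In₃ w a b c

count≡3⇒exactlyThree : ∀ {k} (p : Fin k → Bool) → count p ≡ 3 → ExactlyThree p
count≡3⇒exactlyThree p c₃ with count≡suc⇒peel p c₃
... | a , pa , c₂ with count≡suc⇒peel (remove p a) c₂
... | b , rb , c₁ with count≡suc⇒peel (remove (remove p a) b) c₁
... | c , rc , c₀ with remove-true p rb | remove-true (remove p a) rc
... | pb , b≢a | r′c , c≢b with remove-true p r′c
... | pc , c≢a = record
  { a = a ; b = b ; c = c ; pa = pa ; pb = pb ; pc = pc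
  ; a≢b = ≢-sym b≢a ; a≢c = ≢-sym c≢a ; b≢c = ≢-sym c≢b ; complete = complete }
  where
  complete : ∀ w → p w ≡ true → In₃ w a b c
  complete w pw with w ≟ a | w ≟ b | w ≟ c
  ... | yes w≡a | _       | _       = inj₁ w≡a
  ... | no _    | yes w≡b | _       = inj₂ (inj₁ w≡b)
  ... | no _    | no _    | yes w≡c = inj₂ (inj₂ w≡c)
  ... | no w≢a  | no w≢b  | no w≢c  = ⊥-elim (not-¬ survives (count≡0⇒false p₀ c₀ w))
    where
    p₀ : Fin _ → Bool
    p₀ = remove (remove (remove p a) b) c
    survives : p₀ w ≡ true
    survives = remove-keeps (remove (remove p a) b) (remove-keeps (remove p a) (remove-keeps p pw w≢a) w≢b) w≢c

module _ {A : Set} where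
  In₂-pigeonhole : ∀ {a b s t u : A} → In₂ s a b → In₂ t a b → In₂ u a b → s ≢ t → s ≢ u → t ≢ u → ⊥
  In₂-pigeonhole (inj₁ refl) (inj₁ refl) _ s≢t _ _ = s≢t refl
  In₂-pigeonhole (inj₂ refl) (inj₂ refl) _ s≢t _ _ = s≢t refl
  In₂-pigeonhole (inj₁ refl) (inj₂ refl) (inj₁ refl) _ s≢u _ = s≢u refl
  In₂-pigeonhole (inj₁ refl) (inj₂ refl) (inj₂ refl) _ _ t≢u = t≢u refl
  In₂-pigeonhole (inj₂ refl) (inj₁ refl) (inj₁ refl) _ _ t≢u = t≢u refl
  In₂-pigeonhole (inj₂ refl) (inj₁ refl) (inj₂ refl) _ s≢u _ = s≢u refl

  In₃-pigeonhole : ∀ {a b c s t u w : A} → In₃ s a b c → In₃ t a b c → In₃ u a b c → In₃ w a b c →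
    s ≢ t → s ≢ u → s ≢ w → t ≢ u → t ≢ w → u ≢ w → ⊥
  In₃-pigeonhole (inj₁ refl) t u w s≢t s≢u s≢w =
    In₂-pigeonhole (drop₁ t s≢t) (drop₁ u s≢u) (drop₁ w s≢w)
    where
    drop₁ : ∀ {a b c x : A} → In₃ x a b c → a ≢ x → In₂ x b c
    drop₁ (inj₁ refl) a≢x = ⊥-elim (a≢x refl)
    drop₁ (inj₂ x∈bc) _   = x∈bc
  In₃-pigeonhole (inj₂ (inj₁ refl)) t u w s≢t s≢u s≢w =
    In₂-pigeonhole (drop₂ t s≢t) (drop₂ u s≢u) (drop₂ w s≢w)
    where
    drop₂ : ∀ {a b c x : A} → In₃ x a b c → b ≢ x → In₂ x a c
    drop₂ (inj₁ x≡a)        _   = inj₁ x≡a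
    drop₂ (inj₂ (inj₁ refl)) b≢x = ⊥-elim (b≢x refl)
    drop₂ (inj₂ (inj₂ x≡c)) _   = inj₂ x≡c
  In₃-pigeonhole (inj₂ (inj₂ refl)) t u w s≢t s≢u s≢w =
    In₂-pigeonhole (drop₃ t s≢t) (drop₃ u s≢u) (drop₃ w s≢w)
    where
    drop₃ : ∀ {a b c x : A} → In₃ x a b c → c ≢ x → In₂ x a b
    drop₃ (inj₁ x≡a)        _   = inj₁ x≡a
    drop₃ (inj₂ (inj₁ x≡b)) _   = inj₂ x≡b
    drop₃ (inj₂ (inj₂ refl)) c≢x = ⊥-elim (c≢x refl)

  In₃-swap₂₃ : ∀ {w a b c : A} → In₃ w a b c → In₃ w a c b
  In₃-swap₂₃ (inj₁ w≡a)        = inj₁ w≡a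
  In₃-swap₂₃ (inj₂ (inj₁ w≡b)) = inj₂ (inj₂ w≡b)
  In₃-swap₂₃ (inj₂ (inj₂ w≡c)) = inj₂ (inj₁ w≡c)

  In₃-rotate : ∀ {w a b c : A} → In₃ w a b c → In₃ w b c a
  In₃-rotate (inj₁ w≡a)        = inj₂ (inj₂ w≡a)
  In₃-rotate (inj₂ (inj₁ w≡b)) = inj₁ w≡b
  In₃-rotate (inj₂ (inj₂ w≡c)) = inj₂ (inj₁ w≡c)

∉-pair : ∀ {A : Set} {x a b : A} → x ≢ a → x ≢ b → x ∉ a ∷ b ∷ []
∉-pair x≢a x≢b (here x≡a)         = x≢a x≡a
∉-pair x≢a x≢b (there (here x≡b)) = x≢b x≡b

∉-pair⁻ : ∀ {A : Set} {x a b : A} → x ∉ a ∷ b ∷ [] → x ≢ a × x ≢ b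
∉-pair⁻ x∉ab = (λ x≡a → x∉ab (here x≡a)) , (λ x≡b → x∉ab (there (here x≡b)))

∉-swap : ∀ {A : Set} {v a b : A} {xs} → v ∉ b ∷ a ∷ xs → v ∉ a ∷ b ∷ xs
∉-swap v∉ (here v≡a)         = v∉ (there (here v≡a))
∉-swap v∉ (there (here v≡b)) = v∉ (here v≡b)
∉-swap v∉ (there (there v∈)) = v∉ (there (there v∈))

ordered : ∀ {k} → Fin k → Fin k → Fin k × Fin k
ordered a b with <-cmp a b
... | tri< _ _ _ = a , b
... | tri≈ _ _ _ = a , b
... | tri> _ _ _ = b , a

ordered-spec : ∀ {k} {P : Fin k → Set} {a b} → P a → P b → a ≢ b →
  P (proj₁ (ordered a b)) × P (proj₂ (ordered a b)) × proj₁ (ordered a b) < proj₂ (ordered a b)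
ordered-spec {a = a} {b} pa pb a≢b with <-cmp a b
... | tri< a<b _ _ = pa , pb , a<b
... | tri≈ _ a≡b _ = ⊥-elim (a≢b a≡b)
... | tri> _ _ b<a = pb , pa , b<a

module Walks (G : Graph) where

  walk-start : ∀ {P s t} → WalkIn G P s t → P s
  walk-start (here ps)     = ps
  walk-start (step ps _ _) = ps

  walk-end : ∀ {P s t} → WalkIn G P s t → P t
  walk-end (here pt)    = pt
  walk-end (step _ _ w) = walk-end w

  walk-map : ∀ {P Q : V G → Set} {s t} → (∀ {v} → P v → Q v) → WalkIn G P s t → WalkIn G Q s t
  walk-map f (here p)     = here (f p)
  walk-map f (step p e w) = step (f p) e (walk-map f w)

  _++ʷ_ : ∀ {P s t u} → WalkIn G P s t → WalkIn G P t u → WalkIn G P s u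
  here _     ++ʷ w′ = w′
  step p e w ++ʷ w′ = step p e (w ++ʷ w′)

  walk-reverse : ∀ {P s t} → (∀ {u v} → Edge G u v → Edge G v u) → WalkIn G P s t → WalkIn G P t s
  walk-reverse sym-E (here p)     = here p
  walk-reverse sym-E (step p e w) = walk-reverse sym-E w ++ʷ step (walk-start w) (sym-E e) (here p)

  walk-preserves : ∀ {P s t} (I : V G → Set) → (∀ {u w} → I u → P w → Edge G u w → I w) →
    WalkIn G P s t → I s → I t
  walk-preserves I closed (here _)     is = is
  walk-preserves I closed (step _ e w) is = walk-preserves I closed w (closed is (walk-start w) e)

  record FirstEntry (P Q : V G → Set) (s : V G) : Set where
    field
      {last next} : V G
      walk    : WalkIn G (λ v → P v × ¬ Q v) s last
      edge    : Edge G last next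
      entered : Q next

  first-entry : ∀ {P s t} (Q : V G → Set) → (∀ v → Dec (Q v)) → WalkIn G P s t → Q t →
    Q s ⊎ FirstEntry P Q s
  first-entry Q Q? (here _) qt = inj₁ qt
  first-entry {s = s} Q Q? (step p e w) qt with Q? s
  ... | yes qs = inj₁ qs
  ... | no ¬qs with first-entry Q Q? w qt
  ...   | inj₁ qnext = inj₂ (record { walk = here (p , ¬qs) ; edge = e ; entered = qnext })
  ...   | inj₂ fe    = inj₂ (record { walk = step (p , ¬qs) e walk ; edge = edge ; entered = entered })
    where open FirstEntry fe

module Rematch {A : Set} (_≟ᴬ_ : DecidableEquality A) where

  rematch : (A → A) → (a b c d : A) → A → A
  rematch M a b c d v with v ≟ᴬ a | v ≟ᴬ c | v ≟ᴬ b | v ≟ᴬ d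
  ... | yes _ | _     | _     | _     = c
  ... | no _  | yes _ | _     | _     = a
  ... | no _  | no _  | yes _ | _     = d
  ... | no _  | no _  | no _  | yes _ = b
  ... | no _  | no _  | no _  | no _  = M v

  module Laws (M : A → A) {a b c d : A}
              (a≢b : a ≢ b) (a≢c : a ≢ c) (a≢d : a ≢ d) (b≢c : b ≢ c) (b≢d : b ≢ d) (c≢d : c ≢ d) where

    rematch-a : rematch M a b c d a ≡ c
    rematch-a with a ≟ᴬ a
    ... | yes _  = refl
    ... | no a≢a = ⊥-elim (a≢a refl)

    rematch-c : rematch M a b c d c ≡ a
    rematch-c with c ≟ᴬ a | c ≟ᴬ c
    ... | yes c≡a | _      = ⊥-elim (a≢c (sym c≡a))
    ... | no _    | yes _  = refl
    ... | no _    | no c≢c = ⊥-elim (c≢c refl)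

    rematch-b : rematch M a b c d b ≡ d
    rematch-b with b ≟ᴬ a | b ≟ᴬ c | b ≟ᴬ b
    ... | yes b≡a | _       | _      = ⊥-elim (a≢b (sym b≡a))
    ... | no _    | yes b≡c | _      = ⊥-elim (b≢c b≡c)
    ... | no _    | no _    | yes _  = refl
    ... | no _    | no _    | no b≢b = ⊥-elim (b≢b refl)

    rematch-d : rematch M a b c d d ≡ b
    rematch-d with d ≟ᴬ a | d ≟ᴬ c | d ≟ᴬ b | d ≟ᴬ d
    ... | yes d≡a | _       | _       | _      = ⊥-elim (a≢d (sym d≡a))
    ... | no _    | yes d≡c | _       | _      = ⊥-elim (c≢d (sym d≡c))
    ... | no _    | no _    | yes d≡b | _      = ⊥-elim (b≢d (sym d≡b))
    ... | no _    | no _    | no _    | yes _  = refl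
    ... | no _    | no _    | no _    | no d≢d = ⊥-elim (d≢d refl)

    rematch-other : ∀ {v} → v ≢ a → v ≢ b → v ≢ c → v ≢ d → rematch M a b c d v ≡ M v
    rematch-other {v} v≢a v≢b v≢c v≢d with v ≟ᴬ a | v ≟ᴬ c | v ≟ᴬ b | v ≟ᴬ d
    ... | yes v≡a | _       | _       | _       = ⊥-elim (v≢a v≡a)
    ... | no _    | yes v≡c | _       | _       = ⊥-elim (v≢c v≡c)
    ... | no _    | no _    | yes v≡b | _       = ⊥-elim (v≢b v≡b)
    ... | no _    | no _    | no _    | yes v≡d = ⊥-elim (v≢d v≡d)
    ... | no _    | no _    | no _    | no _    = refl

    rematch-preserves : (Q : A → A → Set) → Q a c → Q c a → Q b d → Q d b →
      (∀ v → v ≢ a → v ≢ b → v ≢ c → v ≢ d → Q v (M v)) → ∀ v → Q v (rematch M a b c d v)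
    rematch-preserves Q qac qca qbd qdb q-other v = by-cases (v ≟ᴬ a) (v ≟ᴬ b) (v ≟ᴬ c) (v ≟ᴬ d)
      where
      by-cases : Dec (v ≡ a) → Dec (v ≡ b) → Dec (v ≡ c) → Dec (v ≡ d) → Q v (rematch M a b c d v)
      by-cases (yes refl) _          _          _          = subst (Q a) (sym rematch-a) qac
      by-cases (no _)     (yes refl) _          _          = subst (Q b) (sym rematch-b) qbd
      by-cases (no _)     (no _)     (yes refl) _          = subst (Q c) (sym rematch-c) qca
      by-cases (no _)     (no _)     (no _)     (yes refl) = subst (Q d) (sym rematch-d) qdb
      by-cases (no v≢a)   (no v≢b)   (no v≢c)   (no v≢d)   =
        subst (Q v) (sym (rematch-other v≢a v≢b v≢c v≢d)) (q-other v v≢a v≢b v≢c v≢d)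

    rematch-involutive : (∀ v → M (M v) ≡ v) → M a ≡ b → M c ≡ d →
      ∀ v → rematch M a b c d (rematch M a b c d v) ≡ v
    rematch-involutive M-inv Ma Mc =
      rematch-preserves (λ v u → rematch M a b c d u ≡ v) rematch-c rematch-a rematch-d rematch-b outside
      where
      outside : ∀ v → v ≢ a → v ≢ b → v ≢ c → v ≢ d → rematch M a b c d (M v) ≡ v
      outside v v≢a v≢b v≢c v≢d = trans (rematch-other Mv≢a Mv≢b Mv≢c Mv≢d) (M-inv v)
        where
        M-injective : ∀ {u w} → M u ≡ M w → u ≡ w
        M-injective {u} {w} eq = trans (sym (M-inv u)) (trans (cong M eq) (M-inv w))
        Mv≢a : M v ≢ a
        Mv≢a eq = v≢b (M-injective (trans eq (trans (sym (M-inv a)) (cong M Ma))))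
        Mv≢b : M v ≢ b
        Mv≢b eq = v≢a (M-injective (trans eq (sym Ma)))
        Mv≢c : M v ≢ c
        Mv≢c eq = v≢d (M-injective (trans eq (trans (sym (M-inv c)) (cong M Mc))))
        Mv≢d : M v ≢ d
        Mv≢d eq = v≢c (M-injective (trans eq (sym Mc)))

module SimpleGraph (G : Graph) (simple : Simple G) where

  edge-sym : ∀ {u v} → Edge G u v → Edge G v u
  edge-sym {u} {v} e = trans (proj₁ simple v u) e

  edge⇒≢ : ∀ {u v} → Edge G u v → u ≢ v
  edge⇒≢ {u} e refl = not-¬ e (proj₂ simple u)

  edge? : ∀ u v → Dec (Edge G u v)
  edge? u v = adj G u v Bool.≟ true

  ¬edge⇒false : ∀ {u v} → ¬ Edge G u v → adj G u v ≡ false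
  ¬edge⇒false ¬e = ¬-not ¬e

module CubicGraph (G : Graph) (cubic : Cubic G) where

  neighbours : ∀ v → ExactlyThree (adj G v)
  neighbours v = count≡3⇒exactlyThree (adj G v) (cubic v)

  neighbours-exhausted : ∀ {v s t u} → Edge G v s → Edge G v t → Edge G v u → s ≢ t → s ≢ u → t ≢ u →
    ∀ w → Edge G v w → In₃ w s t u
  neighbours-exhausted {v} {s} {t} {u} es et eu s≢t s≢u t≢u w ew with w ≟ s | w ≟ t | w ≟ u
  ... | yes w≡s | _       | _       = inj₁ w≡s
  ... | no _    | yes w≡t | _       = inj₂ (inj₁ w≡t)
  ... | no _    | no _    | yes w≡u = inj₂ (inj₂ w≡u)
  ... | no w≢s  | no w≢t  | no w≢u  =
    ⊥-elim (In₃-pigeonhole (complete s es) (complete t et) (complete u eu) (complete w ew)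
                           s≢t s≢u (≢-sym w≢s) t≢u (≢-sym w≢t) (≢-sym w≢u))
    where open ExactlyThree (neighbours v)

  another-neighbour : ∀ {v s t} → s ≢ t → Σ (V G) λ w → Edge G v w × w ≢ s × w ≢ t
  another-neighbour {v} {s} {t} s≢t = pick (avoids a pa) (avoids b pb) (avoids c pc)
    where
    open ExactlyThree (neighbours v)
    Avoiding : Set
    Avoiding = Σ (V G) λ w → Edge G v w × w ≢ s × w ≢ t
    avoids : ∀ w → Edge G v w → Avoiding ⊎ In₂ w s t
    avoids w ew with w ≟ s | w ≟ t
    ... | yes w≡s | _       = inj₂ (inj₁ w≡s)
    ... | no _    | yes w≡t = inj₂ (inj₂ w≡t)
    ... | no w≢s  | no w≢t  = inj₁ (w , ew , w≢s , w≢t)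
    pick : Avoiding ⊎ In₂ a s t → Avoiding ⊎ In₂ b s t → Avoiding ⊎ In₂ c s t → Avoiding
    pick (inj₁ r) _        _        = r
    pick (inj₂ _) (inj₁ r) _        = r
    pick (inj₂ _) (inj₂ _) (inj₁ r) = r
    pick (inj₂ a∈st) (inj₂ b∈st) (inj₂ c∈st) = ⊥-elim (In₂-pigeonhole a∈st b∈st c∈st a≢b a≢c b≢c)

surjective-embedding⇒isomorphic : (G H : Graph) (g : V H → V G) → (∀ i j → g i ≡ g j → i ≡ j) →
  (∀ w → Σ (V H) λ i → g i ≡ w) → (∀ i j → adj G (g i) (g j) ≡ adj H i j) → Isomorphic G H
surjective-embedding⇒isomorphic G H g g-injective g-onto g-adj = f , (f-injective , f-surjective) , f-adj
  where
  f : V G → V H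
  f w = proj₁ (g-onto w)
  g∘f : ∀ w → g (f w) ≡ w
  g∘f w = proj₂ (g-onto w)
  f-injective : ∀ {u w} → f u ≡ f w → u ≡ w
  f-injective {u} {w} eq = trans (sym (g∘f u)) (trans (cong g eq) (g∘f w))
  f-surjective : ∀ i → Σ (V G) λ w → ∀ {u} → u ≡ w → f u ≡ i
  f-surjective i = g i , λ { refl → g-injective _ _ (g∘f (g i)) }
  f-adj : ∀ u w → adj G u w ≡ adj H (f u) (f w)
  f-adj u w = trans (sym (cong₂ (adj G) (g∘f u) (g∘f w))) (g-adj (f u) (f w))

-- In a cubic graph, an edge-preserving injection from a cubic graph already hits all three
-- neighbours of each image vertex, so it is an induced embedding whose image is closed under adjacency.
module CubicEmbedding (G H : Graph) (cubic-G : Cubic G) (cubic-H : Cubic H) (g : V H → V G)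
  (g-injective : ∀ i j → g i ≡ g j → i ≡ j) (g-edge : ∀ i j → Edge H i j → Edge G (g i) (g j)) where

  neighbour-in-image : ∀ i w → Edge G (g i) w → Σ (V H) λ j → Edge H i j × g j ≡ w
  neighbour-in-image i w e = locate (neighbours-exhausted (g-edge i a pa) (g-edge i b pb) (g-edge i c pc)
                                       (g-distinct a≢b) (g-distinct a≢c) (g-distinct b≢c) w e)
    where
    open CubicGraph G cubic-G using (neighbours-exhausted)
    open ExactlyThree (CubicGraph.neighbours H cubic-H i)
    g-distinct : ∀ {j k} → j ≢ k → g j ≢ g k
    g-distinct j≢k gj≡gk = j≢k (g-injective _ _ gj≡gk)
    locate : In₃ w (g a) (g b) (g c) → Σ (V H) λ j → Edge H i j × g j ≡ w
    locate (inj₁ w≡ga)        = a , pa , sym w≡ga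
    locate (inj₂ (inj₁ w≡gb)) = b , pb , sym w≡gb
    locate (inj₂ (inj₂ w≡gc)) = c , pc , sym w≡gc

  adj-image : ∀ i j → adj G (g i) (g j) ≡ adj H i j
  adj-image i j = ⇔→≡ (mk⇔ reflect (g-edge i j))
    where
    reflect : Edge G (g i) (g j) → Edge H i j
    reflect e with neighbour-in-image i (g j) e
    ... | j′ , e′ , gj′≡gj = subst (Edge H i) (g-injective j′ j gj′≡gj) e′

  image-total : Connected G → V H → ∀ w → Σ (V H) λ i → g i ≡ w
  image-total connected i₀ w = walk-preserves InImage extend (connected (g i₀) w) (i₀ , refl)
    where
    open Walks G
    InImage : V G → Set
    InImage v = Σ (V H) λ i → g i ≡ v
    extend : ∀ {u v} → InImage u → ⊤ → Edge G u v → InImage v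
    extend (i , refl) _ e with neighbour-in-image i _ e
    ... | j , _ , gj≡v = j , gj≡v

  isomorphic : Connected G → V H → Isomorphic G H
  isomorphic connected i₀ =
    surjective-embedding⇒isomorphic G H g g-injective (image-total connected i₀) adj-image

EdgesListed : (H : Graph) → List (V H × V H) → Set
EdgesListed H es = ∀ i j → Edge H i j → (i , j) ∈ es ⊎ (j , i) ∈ es

edges-listed? : (H : Graph) (es : List (V H × V H)) → Dec (EdgesListed H es)
edges-listed? H es = all? λ i → all? λ j →
  (adj H i j Bool.≟ true) →-dec ((i , j) ∈? es ⊎-dec (j , i) ∈? es)
  where open DecMembership (×-≡-dec _≟_ _≟_)

K4-cubic : Cubic K4
K4-cubic zero                   = refl
K4-cubic (suc zero)             = refl
K4-cubic (suc (suc zero))       = refl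
K4-cubic (suc (suc (suc zero))) = refl

K4-edges : List (Fin 4 × Fin 4)
K4-edges = (# 0 , # 1) ∷ (# 0 , # 2) ∷ (# 0 , # 3) ∷ (# 1 , # 2) ∷ (# 1 , # 3) ∷ (# 2 , # 3) ∷ []

K4-edges-listed : EdgesListed K4 K4-edges
K4-edges-listed = toWitness {a? = edges-listed? K4 K4-edges} _

C6bar-cubic : Cubic C6bar
C6bar-cubic zero                               = refl
C6bar-cubic (suc zero)                         = refl
C6bar-cubic (suc (suc zero))                   = refl
C6bar-cubic (suc (suc (suc zero)))             = refl
C6bar-cubic (suc (suc (suc (suc zero))))       = refl
C6bar-cubic (suc (suc (suc (suc (suc zero))))) = refl

-- The triangles 024 and 135 of the prism, joined by 03, 25 and 41.
C6bar-edges : List (Fin 6 × Fin 6)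
C6bar-edges = (# 0 , # 2) ∷ (# 2 , # 4) ∷ (# 4 , # 0) ∷ (# 1 , # 3) ∷ (# 3 , # 5) ∷ (# 5 , # 1) ∷
              (# 0 , # 3) ∷ (# 2 , # 5) ∷ (# 4 , # 1) ∷ []

C6bar-edges-listed : EdgesListed C6bar C6bar-edges
C6bar-edges-listed = toWitness {a? = edges-listed? C6bar C6bar-edges} _

contains-cubic-graph⇒isomorphic : (G H : Graph) → Simple G → Cubic G → Connected G → Cubic H → V H →
  (es : List (V H × V H)) → EdgesListed H es →
  (vs : Vec (V G) (n H)) → Distinct vs → All (λ (i , j) → Edge G (lookup vs i) (lookup vs j)) es →
  Isomorphic G H
contains-cubic-graph⇒isomorphic G H simple-G cubic-G connected cubic-H i₀ es listed vs distinct edges =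
  CubicEmbedding.isomorphic G H cubic-G cubic-H (lookup vs) (lookup-injective distinct) edge connected i₀
  where
  open SimpleGraph G simple-G
  edge : ∀ i j → Edge H i j → Edge G (lookup vs i) (lookup vs j)
  edge i j e with listed i j e
  ... | inj₁ ij∈es = All.lookup edges ij∈es
  ... | inj₂ ji∈es = edge-sym (All.lookup edges ji∈es)

module ThreeConnected (G : Graph) (connected₃ : KConnected 3 G) where

  connected : Connected G
  connected u v = walk-map (λ _ → _) (proj₂ connected₃ [] (s≤s z≤n) u v (λ ()) (λ ()))
    where open Walks G

  walk-avoiding-one : ∀ a {u w} → u ≢ a → w ≢ a → WalkIn G (_∉ a ∷ []) u w
  walk-avoiding-one a u≢a w≢a = proj₂ connected₃ (a ∷ []) (s≤s (s≤s z≤n)) _ _ (∉-one u≢a) (∉-one w≢a)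
    where
    ∉-one : ∀ {x} → x ≢ a → x ∉ a ∷ []
    ∉-one x≢a (here x≡a) = x≢a x≡a

  walk-avoiding : ∀ a b {u w} → u ∉ a ∷ b ∷ [] → w ∉ a ∷ b ∷ [] → WalkIn G (_∉ a ∷ b ∷ []) u w
  walk-avoiding a b u∉ w∉ = proj₂ connected₃ (a ∷ b ∷ []) (s≤s (s≤s (s≤s z≤n))) _ _ u∉ w∉

module _ {A B : Set} where
  ⌊⌋∧⌊⌋≡false : (a? : Dec A) (b? : Dec B) → ¬ (A × B) → ⌊ a? ⌋ ∧ ⌊ b? ⌋ ≡ false
  ⌊⌋∧⌊⌋≡false (yes a) (yes b) ¬ab = ⊥-elim (¬ab (a , b))
  ⌊⌋∧⌊⌋≡false (yes _) (no _)  _   = refl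
  ⌊⌋∧⌊⌋≡false (no _)  _       _   = refl

  ⌊⌋∧⌊⌋≡false⁻ : (a? : Dec A) (b? : Dec B) → ⌊ a? ⌋ ∧ ⌊ b? ⌋ ≡ false → ¬ (A × B)
  ⌊⌋∧⌊⌋≡false⁻ (yes _) (no ¬b) _ (_ , b) = ¬b b
  ⌊⌋∧⌊⌋≡false⁻ (no ¬a) _       _ (a , _) = ¬a a

module EdgeDeletion (G : Graph) (a b : V G) where

  G-ab : Graph
  G-ab = deleteEdge G a b

  deleted-edge-intro : ∀ {u v} → Edge G u v → ¬ (u ≡ a × v ≡ b) → ¬ (u ≡ b × v ≡ a) → Edge G-ab u v
  deleted-edge-intro {u} {v} uv ¬ab ¬ba =
    cong₂ (λ e d → e ∧ not d) uv (cong₂ _∨_ (⌊⌋∧⌊⌋≡false (u ≟ a) (v ≟ b) ¬ab) (⌊⌋∧⌊⌋≡false (u ≟ b) (v ≟ a) ¬ba))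

  deleted-edge-elim : ∀ {u v} → Edge G-ab u v → Edge G u v × ¬ (u ≡ a × v ≡ b) × ¬ (u ≡ b × v ≡ a)
  deleted-edge-elim {u} {v} e with adj G u v | ⌊ u ≟ a ⌋ ∧ ⌊ v ≟ b ⌋ in ab | ⌊ u ≟ b ⌋ ∧ ⌊ v ≟ a ⌋ in ba
  ... | true | false | false = refl , ⌊⌋∧⌊⌋≡false⁻ (u ≟ a) (v ≟ b) ab , ⌊⌋∧⌊⌋≡false⁻ (u ≟ b) (v ≟ a) ba

  perfect-matching-avoiding : ∀ {M} → IsPerfectMatching G M → M a ≢ b → IsPerfectMatching G-ab M
  perfect-matching-avoiding {M} (matched , involutive) Ma≢b = matched′ , involutive
    where
    matched′ : ∀ v → Edge G-ab v (M v)
    matched′ v = deleted-edge-intro (matched v) (λ { (refl , Ma≡b) → Ma≢b Ma≡b })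
                   (λ { (refl , Mb≡a) → Ma≢b (trans (cong M (sym Mb≡a)) (involutive b)) })

  walk-avoiding-a : ∀ {s t} → WalkIn G (_∉ a ∷ []) s t → WalkIn G-ab (λ _ → ⊤) s t
  walk-avoiding-a (here _)          = here tt
  walk-avoiding-a {s} (step {w = w} s∉ st walk) = step tt st′ (walk-avoiding-a walk)
    where
    st′ : Edge G-ab s w
    st′ = deleted-edge-intro st (λ (s≡a , _) → s∉ (here s≡a)) (λ (_ , t≡a) → Walks.walk-start G walk (here t≡a))

module ClawFreeCubic (G : Graph) (simple : Simple G) (cubic : Cubic G) (connected₃ : KConnected 3 G)
                     (claw-free : ClawFree G) (¬K4 : ¬ Isomorphic G K4) where
  open SimpleGraph G simple public
  open CubicGraph G cubic public
  open ThreeConnected G connected₃ public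
  open Walks G public

  -- {b, c} would separate {v, a} from the third neighbour of b.
  no-diamond : ∀ {v a b c} → Edge G v a → Edge G v b → Edge G v c → a ≢ b → a ≢ c → b ≢ c →
    Edge G a b → Edge G a c → ¬ Edge G b c → ⊥
  no-diamond {v} {a} {b} {c} va vb vc a≢b a≢c b≢c ab ac ¬bc
    with another-neighbour {b} {v} {a} (edge⇒≢ va)
  ... | w , bw , w≢v , w≢a =
    [ w≢v , w≢a ]′ (walk-preserves Inside closed (walk-avoiding b c v∉ w∉) (inj₁ refl))
    where
    w≢b : w ≢ b
    w≢b refl = edge⇒≢ bw refl
    w≢c : w ≢ c
    w≢c refl = ¬bc bw
    v∉ : v ∉ b ∷ c ∷ []
    v∉ = ∉-pair (edge⇒≢ vb) (edge⇒≢ vc)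
    w∉ : w ∉ b ∷ c ∷ []
    w∉ = ∉-pair w≢b w≢c
    Inside : V G → Set
    Inside x = In₂ x v a
    closed : ∀ {u x} → Inside u → x ∉ b ∷ c ∷ [] → Edge G u x → Inside x
    closed (inj₁ refl) x∉ ux with neighbours-exhausted va vb vc a≢b a≢c b≢c _ ux
    ... | inj₁ x≡a        = inj₂ x≡a
    ... | inj₂ (inj₁ x≡b) = ⊥-elim (proj₁ (∉-pair⁻ x∉) x≡b)
    ... | inj₂ (inj₂ x≡c) = ⊥-elim (proj₂ (∉-pair⁻ x∉) x≡c)
    closed (inj₂ refl) x∉ ux with neighbours-exhausted (edge-sym va) ab ac (edge⇒≢ vb) (edge⇒≢ vc) b≢c _ ux
    ... | inj₁ x≡v        = inj₁ x≡v
    ... | inj₂ (inj₁ x≡b) = ⊥-elim (proj₁ (∉-pair⁻ x∉) x≡b)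
    ... | inj₂ (inj₂ x≡c) = ⊥-elim (proj₂ (∉-pair⁻ x∉) x≡c)

  no-K4-subgraph : ∀ {v a b c} → Edge G v a → Edge G v b → Edge G v c → a ≢ b → a ≢ c → b ≢ c →
    Edge G a b → Edge G a c → Edge G b c → ⊥
  no-K4-subgraph {v} {a} {b} {c} va vb vc a≢b a≢c b≢c ab ac bc =
    ¬K4 (contains-cubic-graph⇒isomorphic G K4 simple cubic connected K4-cubic zero K4-edges K4-edges-listed
          (v ∷ a ∷ b ∷ c ∷ []) distinct (va ∷ vb ∷ vc ∷ ab ∷ ac ∷ bc ∷ []))
    where
    distinct : Distinct (v ∷ a ∷ b ∷ c ∷ [])
    distinct = (edge⇒≢ va ∷ edge⇒≢ vb ∷ edge⇒≢ vc ∷ [])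
             ∷ (a≢b ∷ a≢c ∷ []) ∷ (b≢c ∷ []) ∷ [] ∷ []

  record Neighbourhood (v : V G) : Set where
    constructor triangle-and-outer
    field
      mate₁ mate₂ outer  : V G
      edge₁              : Edge G v mate₁
      edge₂              : Edge G v mate₂
      edge-outer         : Edge G v outer
      mate₁≢mate₂        : mate₁ ≢ mate₂
      mate₁≢outer        : mate₁ ≢ outer
      mate₂≢outer        : mate₂ ≢ outer
      mates-adjacent     : Edge G mate₁ mate₂
      mate₁-outer-apart  : ¬ Edge G mate₁ outer
      mate₂-outer-apart  : ¬ Edge G mate₂ outer
      complete           : ∀ w → Edge G v w → In₃ w mate₁ mate₂ outer

  abstract
    neighbourhood : ∀ v → Neighbourhood v
    neighbourhood v = classify (edge? a b) (edge? a c) (edge? b c)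
      where
      open ExactlyThree (neighbours v)
      classify : Dec (Edge G a b) → Dec (Edge G a c) → Dec (Edge G b c) → Neighbourhood v
      classify (yes ab) (yes ac) (yes bc) = ⊥-elim (no-K4-subgraph pa pb pc a≢b a≢c b≢c ab ac bc)
      classify (yes ab) (yes ac) (no ¬bc) = ⊥-elim (no-diamond pa pb pc a≢b a≢c b≢c ab ac ¬bc)
      classify (yes ab) (no ¬ac) (yes bc) =
        ⊥-elim (no-diamond pb pa pc (≢-sym a≢b) b≢c a≢c (edge-sym ab) bc ¬ac)
      classify (no ¬ab) (yes ac) (yes bc) =
        ⊥-elim (no-diamond pc pa pb (≢-sym a≢c) (≢-sym b≢c) a≢b (edge-sym ac) (edge-sym bc) ¬ab)
      classify (yes ab) (no ¬ac) (no ¬bc) = triangle-and-outer a b c pa pb pc a≢b a≢c b≢c ab ¬ac ¬bc complete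
      classify (no ¬ab) (yes ac) (no ¬bc) =
        triangle-and-outer a c b pa pc pb a≢c a≢b (≢-sym b≢c) ac ¬ab (λ cb → ¬bc (edge-sym cb))
          (λ w vw → In₃-swap₂₃ (complete w vw))
      classify (no ¬ab) (no ¬ac) (yes bc) =
        triangle-and-outer b c a pb pc pa b≢c (≢-sym a≢b) (≢-sym a≢c) bc (λ ba → ¬ab (edge-sym ba))
          (λ ca → ¬ac (edge-sym ca)) (λ w vw → In₃-rotate (complete w vw))
      classify (no ¬ab) (no ¬ac) (no ¬bc) =
        ⊥-elim (claw-free (v , a , b , c , pa , pb , pc , a≢b , a≢c , b≢c ,
                           ¬edge⇒false ¬ab , ¬edge⇒false ¬ac , ¬edge⇒false ¬bc))

  module Nb (v : V G) = Neighbourhood (neighbourhood v)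

  outer : V G → V G
  outer v = Nb.outer v

  outer-edge : ∀ v → Edge G v (outer v)
  outer-edge = Nb.edge-outer

  outer-no-common-neighbour : ∀ {v w} → Edge G v w → ¬ Edge G (outer v) w
  outer-no-common-neighbour {v} {w} vw ow with Nb.complete v w vw
  ... | inj₁ refl        = Nb.mate₁-outer-apart v (edge-sym ow)
  ... | inj₂ (inj₁ refl) = Nb.mate₂-outer-apart v (edge-sym ow)
  ... | inj₂ (inj₂ refl) = edge⇒≢ ow refl

  outer-involutive : ∀ v → outer (outer v) ≡ v
  outer-involutive v with Nb.complete (outer v) v (edge-sym (outer-edge v))
  ... | inj₁ v≡m₁ = ⊥-elim (outer-no-common-neighbour
                      (subst (λ u → Edge G u (Nb.mate₂ (outer v))) (sym v≡m₁) (Nb.mates-adjacent (outer v)))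
                      (Nb.edge₂ (outer v)))
  ... | inj₂ (inj₁ v≡m₂) = ⊥-elim (outer-no-common-neighbour
                      (subst (λ u → Edge G u (Nb.mate₁ (outer v))) (sym v≡m₂)
                             (edge-sym (Nb.mates-adjacent (outer v))))
                      (Nb.edge₁ (outer v)))
  ... | inj₂ (inj₂ v≡o) = sym v≡o

  outer-injective : ∀ {u v} → outer u ≡ outer v → u ≡ v
  outer-injective {u} {v} eq = trans (sym (outer-involutive u)) (trans (cong outer eq) (outer-involutive v))

  outer≢ : ∀ {v} → outer v ≢ v
  outer≢ {v} eq = edge⇒≢ (outer-edge v) (sym eq)

  ≢outer : ∀ {v} → v ≢ outer v
  ≢outer eq = outer≢ (sym eq)

  Mates : V G → V G → Set
  Mates u w = Edge G u w × w ≢ outer u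

  mates⇒≢ : ∀ {u w} → Mates u w → u ≢ w
  mates⇒≢ (uw , _) = edge⇒≢ uw

  mates-sym : ∀ {u w} → Mates u w → Mates w u
  mates-sym {u} {w} (uw , w≢ou) =
    edge-sym uw , λ u≡ow → w≢ou (trans (sym (outer-involutive w)) (cong outer (sym u≡ow)))

  mate-is-listed : ∀ {u w} → Mates u w → In₂ w (Nb.mate₁ u) (Nb.mate₂ u)
  mate-is-listed {u} {w} (uw , w≢ou) with Nb.complete u w uw
  ... | inj₁ w≡m₁        = inj₁ w≡m₁
  ... | inj₂ (inj₁ w≡m₂) = inj₂ w≡m₂
  ... | inj₂ (inj₂ w≡o)  = ⊥-elim (w≢ou w≡o)

  mates-at-most-two : ∀ {u a b c} → Mates u a → Mates u b → Mates u c → a ≢ b → a ≢ c → b ≢ c → ⊥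
  mates-at-most-two ua ub uc = In₂-pigeonhole (mate-is-listed ua) (mate-is-listed ub) (mate-is-listed uc)

  mates-trans : ∀ {u a b} → Mates u a → Mates u b → a ≢ b → Mates a b
  mates-trans {u} {a} {b} ua ub a≢b = ab (mate-is-listed ua) (mate-is-listed ub) , b≢oa
    where
    ab : In₂ a (Nb.mate₁ u) (Nb.mate₂ u) → In₂ b (Nb.mate₁ u) (Nb.mate₂ u) → Edge G a b
    ab (inj₁ refl) (inj₁ refl) = ⊥-elim (a≢b refl)
    ab (inj₁ refl) (inj₂ refl) = Nb.mates-adjacent u
    ab (inj₂ refl) (inj₁ refl) = edge-sym (Nb.mates-adjacent u)
    ab (inj₂ refl) (inj₂ refl) = ⊥-elim (a≢b refl)
    b≢oa : b ≢ outer a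
    b≢oa b≡oa = outer-no-common-neighbour (edge-sym (proj₁ ua))
                  (subst (λ x → Edge G x u) b≡oa (edge-sym (proj₁ ub)))

  listed-mates : ∀ u → Mates u (Nb.mate₁ u) × Mates u (Nb.mate₂ u)
  listed-mates u = (Nb.edge₁ u , Nb.mate₁≢outer u) , (Nb.edge₂ u , Nb.mate₂≢outer u)

  third-mate : ∀ {x y} → Mates x y → Σ (V G) λ z → Mates x z × z ≢ y
  third-mate {x} {y} xy with mate-is-listed xy
  ... | inj₁ y≡m₁ = Nb.mate₂ x , proj₂ (listed-mates x) , λ m₂≡y → Nb.mate₁≢mate₂ x (trans (sym y≡m₁) (sym m₂≡y))
  ... | inj₂ y≡m₂ = Nb.mate₁ x , proj₁ (listed-mates x) , λ m₁≡y → Nb.mate₁≢mate₂ x (trans m₁≡y y≡m₂)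

  mates-exhausted : ∀ {x y z w} → Mates x y → Mates x z → y ≢ z → Mates x w → In₂ w y z
  mates-exhausted {x} {y} {z} {w} xy xz y≢z xw with w ≟ y | w ≟ z
  ... | yes w≡y | _       = inj₁ w≡y
  ... | no _    | yes w≡z = inj₂ w≡z
  ... | no w≢y  | no w≢z  = ⊥-elim (mates-at-most-two xy xz xw y≢z (≢-sym w≢y) (≢-sym w≢z))

  outer-or-mate : ∀ {u w} → Edge G u w → w ≡ outer u ⊎ Mates u w
  outer-or-mate {u} {w} uw with w ≟ outer u
  ... | yes w≡o = inj₁ w≡o
  ... | no w≢o  = inj₂ (uw , w≢o)

  mates? : ∀ u w → Dec (Mates u w)
  mates? u w with edge? u w | w ≟ outer u
  ... | yes uw | no w≢o  = yes (uw , w≢o)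
  ... | yes _  | yes w≡o = no λ m → proj₂ m w≡o
  ... | no ¬uw | _       = no λ m → ¬uw (proj₁ m)

  SameTriangle : V G → V G → Set
  SameTriangle u w = u ≡ w ⊎ Mates u w

  same-triangle-sym : ∀ {u w} → SameTriangle u w → SameTriangle w u
  same-triangle-sym (inj₁ u≡w) = inj₁ (sym u≡w)
  same-triangle-sym (inj₂ uw)  = inj₂ (mates-sym uw)

  same-triangle-trans : ∀ {a b c} → SameTriangle a b → SameTriangle b c → SameTriangle a c
  same-triangle-trans (inj₁ refl) bc          = bc
  same-triangle-trans (inj₂ ab)   (inj₁ refl) = inj₂ ab
  same-triangle-trans {a} {b} {c} (inj₂ ab) (inj₂ bc) with a ≟ c
  ... | yes a≡c = inj₁ a≡c
  ... | no a≢c  = inj₂ (mates-trans (mates-sym ab) bc a≢c)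

  same-triangle? : ∀ u w → Dec (SameTriangle u w)
  same-triangle? u w = (u ≟ w) ⊎-dec (mates? u w)

  same-triangle⇒mates : ∀ {u w} → SameTriangle u w → u ≢ w → Mates u w
  same-triangle⇒mates (inj₁ u≡w) u≢w = ⊥-elim (u≢w u≡w)
  same-triangle⇒mates (inj₂ uw)  _   = uw

  neighbour-via-mates : ∀ {u a b w} → Mates u a → Mates u b → a ≢ b → Edge G u w → w ≡ outer u ⊎ In₂ w a b
  neighbour-via-mates ua ub a≢b uw with outer-or-mate uw
  ... | inj₁ w≡o = inj₁ w≡o
  ... | inj₂ uw′ = inj₂ (mates-exhausted ua ub a≢b uw′)

module LinkedTriangles (G : Graph) (simple : Simple G) (cubic : Cubic G) (connected₃ : KConnected 3 G)
                       (claw-free : ClawFree G) (¬K4 : ¬ Isomorphic G K4) (¬C6bar : ¬ Isomorphic G C6bar) where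
  open ClawFreeCubic G simple cubic connected₃ claw-free ¬K4

  -- Two triangles xyz and x′y′c with outer edges xx′ and yy′: zc closes a prism, otherwise {z, c} is a cut.
  module Linked {x y} (xy : Mates x y) (x′y′ : Mates (outer x) (outer y)) where
    z : V G
    z = proj₁ (third-mate xy)
    xz : Mates x z
    xz = proj₁ (proj₂ (third-mate xy))
    z≢y : z ≢ y
    z≢y = proj₂ (proj₂ (third-mate xy))
    c : V G
    c = proj₁ (third-mate x′y′)
    x′c : Mates (outer x) c
    x′c = proj₁ (proj₂ (third-mate x′y′))
    c≢y′ : c ≢ outer y
    c≢y′ = proj₂ (proj₂ (third-mate x′y′))
    yz : Mates y z
    yz = mates-trans xy xz (≢-sym z≢y)
    y′c : Mates (outer y) c
    y′c = mates-trans x′y′ x′c (≢-sym c≢y′)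

    ≢c-of-outer : ∀ {u} → Mates (outer u) c → u ≢ c
    ≢c-of-outer {u} uc u≡c = proj₂ uc (trans (sym u≡c) (sym (outer-involutive u)))

    z≢c : z ≢ c
    z≢c z≡c with mates-exhausted (mates-sym xz) (mates-sym yz) (mates⇒≢ xy)
                                 (mates-sym (subst (Mates (outer x)) (sym z≡c) x′c))
    ... | inj₁ x′≡x = outer≢ x′≡x
    ... | inj₂ x′≡y = proj₂ xy (sym x′≡y)

    prism : Edge G z c → Isomorphic G C6bar
    prism zc = contains-cubic-graph⇒isomorphic G C6bar simple cubic connected C6bar-cubic zero
      C6bar-edges C6bar-edges-listed (x ∷ c ∷ y ∷ outer x ∷ z ∷ outer y ∷ []) distinct
      (proj₁ xy ∷ proj₁ yz ∷ edge-sym (proj₁ xz) ∷ edge-sym (proj₁ x′c) ∷ proj₁ x′y′ ∷ proj₁ y′c ∷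
       outer-edge x ∷ outer-edge y ∷ zc ∷ [])
      where
      distinct : Distinct (x ∷ c ∷ y ∷ outer x ∷ z ∷ outer y ∷ [])
      distinct = (≢c-of-outer x′c ∷ mates⇒≢ xy ∷ ≢outer ∷ mates⇒≢ xz ∷ proj₂ (mates-sym xy) ∷ [])
               ∷ (≢-sym (≢c-of-outer y′c) ∷ ≢-sym (mates⇒≢ x′c) ∷ ≢-sym z≢c ∷ ≢-sym (mates⇒≢ y′c) ∷ [])
               ∷ (proj₂ xy ∷ mates⇒≢ yz ∷ ≢outer ∷ [])
               ∷ (≢-sym (proj₂ xz) ∷ mates⇒≢ x′y′ ∷ [])
               ∷ (proj₂ yz ∷ [])
               ∷ [] ∷ []

    InLinkedPair : V G → Set
    InLinkedPair v = In₂ v x y ⊎ In₂ v (outer x) (outer y)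

    linked-pair-closed : ∀ {u w} → InLinkedPair u → w ∉ z ∷ c ∷ [] → Edge G u w → InLinkedPair w
    linked-pair-closed (inj₁ (inj₁ refl)) w∉ uw with neighbour-via-mates xy xz (≢-sym z≢y) uw
    ... | inj₁ w≡x′        = inj₂ (inj₁ w≡x′)
    ... | inj₂ (inj₁ w≡y)  = inj₁ (inj₂ w≡y)
    ... | inj₂ (inj₂ w≡z)  = ⊥-elim (proj₁ (∉-pair⁻ w∉) w≡z)
    linked-pair-closed (inj₁ (inj₂ refl)) w∉ uw with neighbour-via-mates (mates-sym xy) yz (mates⇒≢ xz) uw
    ... | inj₁ w≡y′        = inj₂ (inj₂ w≡y′)
    ... | inj₂ (inj₁ w≡x)  = inj₁ (inj₁ w≡x)
    ... | inj₂ (inj₂ w≡z)  = ⊥-elim (proj₁ (∉-pair⁻ w∉) w≡z)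
    linked-pair-closed (inj₂ (inj₁ refl)) w∉ uw with neighbour-via-mates x′y′ x′c (≢-sym c≢y′) uw
    ... | inj₁ w≡x″        = inj₁ (inj₁ (trans w≡x″ (outer-involutive x)))
    ... | inj₂ (inj₁ w≡y′) = inj₂ (inj₂ w≡y′)
    ... | inj₂ (inj₂ w≡c)  = ⊥-elim (proj₂ (∉-pair⁻ w∉) w≡c)
    linked-pair-closed (inj₂ (inj₂ refl)) w∉ uw with neighbour-via-mates (mates-sym x′y′) y′c (mates⇒≢ x′c) uw
    ... | inj₁ w≡y″        = inj₁ (inj₂ (trans w≡y″ (outer-involutive y)))
    ... | inj₂ (inj₁ w≡x′) = inj₂ (inj₁ w≡x′)
    ... | inj₂ (inj₂ w≡c)  = ⊥-elim (proj₂ (∉-pair⁻ w∉) w≡c)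

    outer-z-not-in-linked-pair : ¬ InLinkedPair (outer z)
    outer-z-not-in-linked-pair (inj₁ (inj₁ z′≡x)) = proj₂ (mates-sym xz) (sym z′≡x)
    outer-z-not-in-linked-pair (inj₁ (inj₂ z′≡y)) = proj₂ (mates-sym yz) (sym z′≡y)
    outer-z-not-in-linked-pair (inj₂ (inj₁ z′≡x′)) = mates⇒≢ xz (sym (outer-injective z′≡x′))
    outer-z-not-in-linked-pair (inj₂ (inj₂ z′≡y′)) = mates⇒≢ yz (sym (outer-injective z′≡y′))

    cut : ¬ Edge G z c → ⊥
    cut ¬zc = outer-z-not-in-linked-pair
      (walk-preserves InLinkedPair linked-pair-closed (walk-avoiding z c x∉ z′∉) (inj₁ (inj₁ refl)))
      where
      x∉ : x ∉ z ∷ c ∷ []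
      x∉ = ∉-pair (mates⇒≢ xz) (≢c-of-outer x′c)
      z′∉ : outer z ∉ z ∷ c ∷ []
      z′∉ = ∉-pair outer≢ (λ z′≡c → ¬zc (subst (Edge G z) z′≡c (outer-edge z)))

  no-triangles-joined-twice : ∀ {x y} → Mates x y → ¬ Mates (outer x) (outer y)
  no-triangles-joined-twice xy x′y′ = decide (edge? z c)
    where
    open Linked xy x′y′
    decide : Dec (Edge G z c) → ⊥
    decide (yes zc) = ¬C6bar (prism zc)
    decide (no ¬zc) = cut ¬zc

module PerfectMatchings (G : Graph) (simple : Simple G) (cubic : Cubic G) (connected₃ : KConnected 3 G)
                        (claw-free : ClawFree G) (¬K4 : ¬ Isomorphic G K4) where
  open ClawFreeCubic G simple cubic connected₃ claw-free ¬K4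
  open Rematch {V G} _≟_
  open DecMembership {A = V G} _≟_ using (_∈?_)

  record NearMatching (x r : V G) : Set where
    field
      M          : V G → V G
      involutive : ∀ v → M (M v) ≡ v
      matched    : ∀ v → v ≢ r → v ≢ x → Edge G v (M v)
      r↦x        : M r ≡ x

    x↦r : M x ≡ r
    x↦r = trans (cong M (sym r↦x)) (involutive r)

  near-matching-closes : ∀ {x y} (N : NearMatching x y) → Edge G x y → IsPerfectMatching G (NearMatching.M N)
  near-matching-closes {x} {y} N xy = perfect , involutive
    where
    open NearMatching N
    perfect : ∀ v → Edge G v (M v)
    perfect v = by-cases (v ≟ x) (v ≟ y)
      where
      by-cases : Dec (v ≡ x) → Dec (v ≡ y) → Edge G v (M v)
      by-cases (yes refl) _          = subst (Edge G x) (sym x↦r) xy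
      by-cases (no _)     (yes refl) = subst (Edge G y) (sym r↦x) (edge-sym xy)
      by-cases (no v≢x)   (no v≢y)   = matched v v≢y v≢x

  -- Extend the alternating path ending in the unmatched pair (w, x) by the triangle edge
  -- from w to outer q and the outer edge from outer q to q.
  reroute : ∀ {x w q} (N : NearMatching x w) → let open NearMatching N in
    Mates w (outer q) → M (outer q) ≡ q → w ≢ x → q ≢ x → outer q ≢ x → q ≢ w →
    Σ (NearMatching x q) λ N′ → ∀ v → v ≢ w → v ≢ x → v ≢ outer q → v ≢ q → NearMatching.M N′ v ≡ M v
  reroute {x} {w} {q} N wq′ Mq′ w≢x q≢x q′≢x q≢w = N′ , λ v → rematch-other
    where
    open NearMatching N
    open Laws M w≢x (mates⇒≢ wq′) (≢-sym q≢w) (≢-sym q′≢x) (≢-sym q≢x) outer≢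
    NearEdge : V G → V G → Set
    NearEdge v u = v ≢ q → v ≢ x → Edge G v u
    untouched-near-edge : ∀ v → v ≢ w → v ≢ x → v ≢ outer q → v ≢ q → NearEdge v (M v)
    untouched-near-edge v v≢w v≢x _ _ _ _ = matched v v≢w v≢x
    N′ : NearMatching x q
    N′ = record
      { M          = rematch M w x (outer q) q
      ; involutive = rematch-involutive involutive r↦x Mq′
      ; matched    = rematch-preserves NearEdge (λ _ _ → proj₁ wq′) (λ _ _ → edge-sym (proj₁ wq′))
                       (λ _ x≢x → ⊥-elim (x≢x refl)) (λ q≢q _ → ⊥-elim (q≢q refl)) untouched-near-edge
      ; r↦x        = rematch-d
      }

  -- Breadth-first search from the triangle of outer x through unblocked vertices, where
  -- Layer j collects what is reachable using at most j further outer edges.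
  module Layers (B : V G → Set) (B? : ∀ v → Dec (B v)) (x : V G) (Bx : B x) (¬Bx′ : ¬ B (outer x)) where

    Layer : ℕ → V G → Set
    Layer zero    v = SameTriangle (outer x) v × ¬ B v
    Layer (suc j) v = Layer j v ⊎ (¬ B v × Σ (V G) λ u → SameTriangle v u × ¬ B u × Layer j (outer u))

    layer? : ∀ j v → Dec (Layer j v)
    layer? zero    v = same-triangle? (outer x) v ×-dec ¬? (B? v)
    layer? (suc j) v = layer? j v ⊎-dec
      (¬? (B? v) ×-dec any? (λ u → same-triangle? v u ×-dec ¬? (B? u) ×-dec layer? j (outer u)))

    layer-unblocked : ∀ {j v} → Layer j v → ¬ B v
    layer-unblocked {zero}  (_ , ¬Bv)        = ¬Bv
    layer-unblocked {suc j} (inj₁ v∈j)       = layer-unblocked v∈j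
    layer-unblocked {suc j} (inj₂ (¬Bv , _)) = ¬Bv

    layer-≢ : ∀ {j v u} → Layer j v → B u → v ≢ u
    layer-≢ v∈j Bu refl = layer-unblocked v∈j Bu

    layer-closed : ∀ {j v w} → Layer j v → SameTriangle v w → ¬ B w → Layer j w
    layer-closed {zero}  (x′v , _) vw ¬Bw = same-triangle-trans x′v vw , ¬Bw
    layer-closed {suc j} (inj₁ v∈j) vw ¬Bw = inj₁ (layer-closed v∈j vw ¬Bw)
    layer-closed {suc j} (inj₂ (_ , u , vu , ¬Bu , u′∈j)) vw ¬Bw =
      inj₂ (¬Bw , u , same-triangle-trans (same-triangle-sym vw) vu , ¬Bu , u′∈j)

    layer-mono : ∀ {i j v} → i ℕ.≤ j → Layer i v → Layer j v
    layer-mono {zero}  {zero}  _         v∈i = v∈i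
    layer-mono {zero}  {suc j} _         v∈i = inj₁ (layer-mono {zero} {j} z≤n v∈i)
    layer-mono {suc i} {suc j} (s≤s i≤j) (inj₁ v∈i) = inj₁ (layer-mono i≤j v∈i)
    layer-mono {suc i} {suc j} (s≤s i≤j) (inj₂ (¬Bv , u , vu , ¬Bu , u′∈i)) =
      inj₂ (¬Bv , u , vu , ¬Bu , layer-mono i≤j u′∈i)

    layer-reachable : ∀ {k s t} → Layer k s → WalkIn G (λ v → ¬ B v) s t → Σ ℕ λ k′ → Layer k′ t
    layer-reachable {k} s∈k (here _) = k , s∈k
    layer-reachable {k} {s} s∈k (step {w = w} _ sw walk) with outer-or-mate sw
    ... | inj₁ w≡s′ = layer-reachable {suc k} (inj₂ (walk-start walk , w , inj₁ refl , walk-start walk , w′∈k)) walk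
      where
      w′∈k : Layer k (outer w)
      w′∈k = subst (Layer k) (sym (trans (cong outer w≡s′) (outer-involutive s))) s∈k
    ... | inj₂ sw′ = layer-reachable (layer-closed s∈k (inj₂ sw′) (walk-start walk)) walk

    Earlier : ℕ → V G → Set
    Earlier zero    v = ⊥
    Earlier (suc j) v = Layer j v

    earlier⇒layer : ∀ {i j v} → i ℕ.≤ j → Earlier i v → Layer j v
    earlier⇒layer {suc i} i≤j v∈i = layer-mono (≤-trans (n≤1+n i) i≤j) v∈i

    Entry : ℕ → V G → Set
    Entry zero    r = r ≡ outer x
    Entry (suc j) r = Layer j (outer r)

    entry-outer : ∀ {i r} → Entry i (outer r) → r ≡ x ⊎ Earlier i r
    entry-outer {zero}      r′≡x′ = inj₁ (outer-injective r′≡x′)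
    entry-outer {suc i} {r} r″∈i  = inj₂ (subst (Layer i) (outer-involutive r) r″∈i)

    Port : ℕ → V G → Set
    Port i w = Layer i w × ¬ Earlier i w × Entry i w

    first-layer : ∀ j {v} → Layer j v → Σ ℕ λ i → i ℕ.≤ j × Layer i v × ¬ Earlier i v
    first-layer zero v∈j = zero , z≤n , v∈j , λ ()
    first-layer (suc j) {v} v∈j with layer? j v
    ... | no v∉j = suc j , ≤-refl , v∈j , v∉j
    ... | yes v∈j′ with first-layer j v∈j′
    ...   | i , i≤j , v∈i , fresh = i , ≤-trans i≤j (n≤1+n j) , v∈i , fresh

    port-in-triangle : ∀ i {v} → Layer i v → ¬ Earlier i v → Σ (V G) λ w → SameTriangle v w × Port i w
    port-in-triangle zero (x′v , _) _ = outer x , same-triangle-sym x′v , (inj₁ refl , ¬Bx′) , (λ ()) , refl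
    port-in-triangle (suc j) (inj₁ v∈j) fresh = ⊥-elim (fresh v∈j)
    port-in-triangle (suc j) (inj₂ (¬Bv , u , vu , ¬Bu , u′∈j)) fresh =
      u , vu , inj₂ (¬Bu , u , inj₁ refl , ¬Bu , u′∈j) , u-fresh , u′∈j
      where
      u-fresh : ¬ Layer j u
      u-fresh u∈j = fresh (layer-closed u∈j (same-triangle-sym vu) ¬Bv)

    port-of : ∀ {j p} → Layer j p → Σ ℕ λ i → i ℕ.≤ j × ¬ Earlier i p × Σ (V G) λ w → SameTriangle p w × Port i w
    port-of {j} p∈j with first-layer j p∈j
    ... | i , i≤j , p∈i , fresh = i , i≤j , fresh , port-in-triangle i p∈i fresh

    record Rerouted (r : V G) (i : ℕ) : Set where
      field
        near      : NearMatching x r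
        untouched : ∀ v → v ≢ r → v ≢ x → ¬ Earlier i v → NearMatching.M near v ≡ outer v

    initial : Rerouted (outer x) zero
    initial = record
      { near      = record { M = outer ; involutive = outer-involutive
                           ; matched = λ v _ _ → outer-edge v ; r↦x = outer-involutive x }
      ; untouched = λ _ _ _ _ → refl
      }

    -- Reroute from the port w of the first layer that contains outer q; since the search reached
    -- that layer through w, the outer matching is still in place at outer q.
    extend : ∀ {j q} → Layer j (outer q) → q ≢ x → ¬ Layer j q →
      (∀ {i w} → i ℕ.≤ j → Port i w → Rerouted w i) → Rerouted q (suc j)
    extend {j} {q} q′∈j q≢x q∉j rerouted-below with port-of q′∈j
    ... | i , i≤j , q′-fresh , w , q′w , w-port@(w∈i , _ , w-entry) =
      record { near = proj₁ extended ; untouched = untouched′ }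
      where
      open Rerouted (rerouted-below i≤j w-port)
      open NearMatching near
      w∈j : Layer j w
      w∈j = layer-mono i≤j w∈i
      ∉j⇒≢w : ∀ {v} → ¬ Layer j v → v ≢ w
      ∉j⇒≢w v∉j v≡w = v∉j (subst (Layer j) (sym v≡w) w∈j)
      w≢q′ : w ≢ outer q
      w≢q′ w≡q′ = [ q≢x , (λ q∈i → q∉j (earlier⇒layer i≤j q∈i)) ]′ (entry-outer {i} (subst (Entry i) w≡q′ w-entry))
      Mq′ : M (outer q) ≡ q
      Mq′ = trans (untouched (outer q) (≢-sym w≢q′) (layer-≢ q′∈j Bx) q′-fresh) (outer-involutive q)
      extended : Σ (NearMatching x q) λ N′ → ∀ v → v ≢ w → v ≢ x → v ≢ outer q → v ≢ q → NearMatching.M N′ v ≡ M v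
      extended = reroute near (mates-sym (same-triangle⇒mates q′w (≢-sym w≢q′))) Mq′
                   (layer-≢ w∈i Bx) q≢x (layer-≢ q′∈j Bx) (∉j⇒≢w q∉j)
      untouched′ : ∀ v → v ≢ q → v ≢ x → ¬ Layer j v → NearMatching.M (proj₁ extended) v ≡ outer v
      untouched′ v v≢q v≢x v∉j =
        trans (proj₂ extended v (∉j⇒≢w v∉j) v≢x (λ v≡q′ → v∉j (subst (Layer j) (sym v≡q′) q′∈j)) v≢q)
              (untouched v (∉j⇒≢w v∉j) v≢x (λ v∈i → v∉j (earlier⇒layer i≤j v∈i)))

    rerouted : ∀ k {i r} → i ℕ.≤ k → Port i r → Rerouted r i
    rerouted k       {zero}  _         (_ , _ , refl)        = initial
    rerouted (suc k) {suc j} (s≤s j≤k) (r∈ , r-fresh , r′∈j) =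
      extend r′∈j (layer-≢ r∈ Bx) r-fresh (λ i≤j → rerouted k (≤-trans i≤j j≤k))

  -- An alternating cycle x y (outer y) … (outer x) x, read off a walk avoiding B.
  perfect-matching-via-walk : ∀ {x y} (B : V G → Set) → (∀ v → Dec (B v)) → B x → B y → Mates x y →
    WalkIn G (λ v → ¬ B v) (outer x) (outer y) →
    Σ (V G → V G) λ M → IsPerfectMatching G M × M x ≡ y × (∀ v → B v → v ≢ x → v ≢ y → M v ≡ outer v)
  perfect-matching-via-walk {x} {y} B B? Bx By xy walk =
    M , near-matching-closes near (proj₁ xy) , x↦r , blocked-untouched
    where
    open Layers B B? x Bx (walk-start walk)
    reached : Σ ℕ λ k → Layer k (outer y)
    reached = layer-reachable {zero} (inj₁ refl , walk-start walk) walk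
    open Rerouted (extend (proj₂ reached) (≢-sym (mates⇒≢ xy)) (λ y∈k → layer-unblocked y∈k By)
                          (rerouted (proj₁ reached)))
    open NearMatching near
    blocked-untouched : ∀ v → B v → v ≢ x → v ≢ y → M v ≡ outer v
    blocked-untouched v Bv v≢x v≢y = untouched v v≢y v≢x (λ v∈k → layer-unblocked v∈k Bv)

  -- Leaving outer a while avoiding a and β (3-connectivity), the first of b, z, outer b to be hit
  -- is outer b, or z entered from outer z.
  module ExitWalk {a b z β} (ab : Mates a b) (az : Mates a z) (b≢z : b ≢ z)
                  (β≢a′ : β ≢ outer a) (β≢b′ : β ≢ outer b) where
    bz : Mates b z
    bz = mates-trans ab az b≢z
    b′≢a : outer b ≢ a
    b′≢a b′≡a = proj₂ (mates-sym ab) (sym b′≡a)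

    Target : V G → Set
    Target v = v ≡ b ⊎ v ≡ z ⊎ v ≡ outer b
    target? : ∀ v → Dec (Target v)
    target? v = (v ≟ b) ⊎-dec (v ≟ z) ⊎-dec (v ≟ outer b)

    Avoiding : V G → Set
    Avoiding v = v ∉ a ∷ b ∷ z ∷ β ∷ []
    avoiding : ∀ {v} → v ∉ a ∷ β ∷ [] × ¬ Target v → Avoiding v
    avoiding (v∉aβ , _)  (here v≡a)                         = v∉aβ (here v≡a)
    avoiding (_    , ¬t) (there (here v≡b))                 = ¬t (inj₁ v≡b)
    avoiding (_    , ¬t) (there (there (here v≡z)))         = ¬t (inj₂ (inj₁ v≡z))
    avoiding (v∉aβ , _)  (there (there (there (here v≡β)))) = v∉aβ (there (here v≡β))

    b′-avoiding : Avoiding (outer b)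
    b′-avoiding (here b′≡a)                         = b′≢a b′≡a
    b′-avoiding (there (here b′≡b))                 = outer≢ b′≡b
    b′-avoiding (there (there (here b′≡z)))         = proj₂ bz (sym b′≡z)
    b′-avoiding (there (there (there (here b′≡β))))  = β≢b′ (sym b′≡β)

    Exit : Set
    Exit = WalkIn G Avoiding (outer a) (outer b) ⊎ WalkIn G Avoiding (outer a) (outer z)

    entering : ∀ {u t} → WalkIn G Avoiding (outer a) u → u ∉ a ∷ β ∷ [] × ¬ Target u →
      Edge G u t → Target t → Exit
    entering a′→u (u∉aβ , ¬tu) ut (inj₁ refl)
      with neighbour-via-mates (mates-sym ab) bz (mates⇒≢ az) (edge-sym ut)
    ... | inj₁ u≡b′       = ⊥-elim (¬tu (inj₂ (inj₂ u≡b′)))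
    ... | inj₂ (inj₁ u≡a) = ⊥-elim (u∉aβ (here u≡a))
    ... | inj₂ (inj₂ u≡z) = ⊥-elim (¬tu (inj₂ (inj₁ u≡z)))
    entering a′→u (u∉aβ , ¬tu) ut (inj₂ (inj₁ refl))
      with neighbour-via-mates (mates-sym az) (mates-sym bz) (mates⇒≢ ab) (edge-sym ut)
    ... | inj₁ u≡z′       = inj₂ (subst (WalkIn G Avoiding (outer a)) u≡z′ a′→u)
    ... | inj₂ (inj₁ u≡a) = ⊥-elim (u∉aβ (here u≡a))
    ... | inj₂ (inj₂ u≡b) = ⊥-elim (¬tu (inj₁ u≡b))
    entering a′→u u-ok ut (inj₂ (inj₂ refl)) = inj₁ (a′→u ++ʷ step (avoiding u-ok) ut (here b′-avoiding))

    a′→b′ : WalkIn G (_∉ a ∷ β ∷ []) (outer a) (outer b)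
    a′→b′ = walk-avoiding a β (∉-pair outer≢ (≢-sym β≢a′)) (∉-pair b′≢a (≢-sym β≢b′))

    exit : Exit
    exit with first-entry Target target? a′→b′ (inj₂ (inj₂ refl))
    ... | inj₁ (inj₁ a′≡b)         = ⊥-elim (proj₂ ab (sym a′≡b))
    ... | inj₁ (inj₂ (inj₁ a′≡z))  = ⊥-elim (proj₂ az (sym a′≡z))
    ... | inj₁ (inj₂ (inj₂ a′≡b′)) = ⊥-elim (mates⇒≢ ab (outer-injective a′≡b′))
    ... | inj₂ fe = entering (walk-map avoiding walk) (walk-end walk) edge entered
      where open FirstEntry fe

  walk-between-outers : ∀ {x y z β} → Mates x y → Mates x z → y ≢ z → β ≢ outer x → β ≢ outer y →
    WalkIn G (_∉ x ∷ y ∷ z ∷ β ∷ []) (outer x) (outer y)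
  walk-between-outers xy xz y≢z β≢x′ β≢y′
    with ExitWalk.exit xy xz y≢z β≢x′ β≢y′
       | ExitWalk.exit (mates-sym xy) (mates-trans xy xz y≢z) (mates⇒≢ xz) β≢y′ β≢x′
  ... | inj₁ x′→y′ | _          = x′→y′
  ... | inj₂ _     | inj₁ y′→x′ = walk-reverse edge-sym (walk-map ∉-swap y′→x′)
  ... | inj₂ x′→z′ | inj₂ y′→z′ = x′→z′ ++ʷ walk-reverse edge-sym (walk-map ∉-swap y′→z′)

  triangle-edge-matching : ∀ {x y z β} → Mates x y → Mates x z → y ≢ z →
    β ≢ x → β ≢ y → β ≢ outer x → β ≢ outer y →
    Σ (V G → V G) λ M → IsPerfectMatching G M × M x ≡ y × M β ≡ outer β
  triangle-edge-matching {x} {y} {z} {β} xy xz y≢z β≢x β≢y β≢x′ β≢y′ =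
    let M , perfect , Mx , blocked-untouched = via-walk in
    M , perfect , Mx , blocked-untouched β (there (there (there (here refl)))) β≢x β≢y
    where
    Blocked : V G → Set
    Blocked v = v ∈ x ∷ y ∷ z ∷ β ∷ []
    via-walk : Σ (V G → V G) λ M → IsPerfectMatching G M × M x ≡ y × (∀ v → Blocked v → v ≢ x → v ≢ y → M v ≡ outer v)
    via-walk = perfect-matching-via-walk Blocked (_∈? x ∷ y ∷ z ∷ β ∷ []) (here refl) (there (here refl)) xy
                 (walk-between-outers xy xz y≢z β≢x′ β≢y′)

module Removability (G : Graph) (simple : Simple G) (cubic : Cubic G) (connected₃ : KConnected 3 G)
                    (claw-free : ClawFree G) (¬K4 : ¬ Isomorphic G K4) (¬C6bar : ¬ Isomorphic G C6bar) where
  open ClawFreeCubic G simple cubic connected₃ claw-free ¬K4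
  open LinkedTriangles G simple cubic connected₃ claw-free ¬K4 ¬C6bar
  open PerfectMatchings G simple cubic connected₃ claw-free ¬K4

  mates⇒in-triangle : ∀ {u v} → Mates u v → InTriangle G u v
  mates⇒in-triangle uv with third-mate uv
  ... | w , uw , w≢v = proj₁ uv , w , proj₁ uw , proj₁ (mates-trans uv uw (≢-sym w≢v))

  in-triangle⇒mates : ∀ {u v} → InTriangle G u v → Mates u v
  in-triangle⇒mates {u} (uv , w , uw , vw) =
    uv , λ v≡u′ → outer-no-common-neighbour uw (subst (λ t → Edge G t w) v≡u′ vw)

  outer-not-removable : ∀ u → ¬ Removable G u (outer u)
  -- The triangle edge opposite u can only be matched if u takes its outer edge.
  outer-not-removable u (_ , _ , _ , covered) = unmatchable (covered (Nb.mate₁ u) (Nb.mate₂ u) m₁m₂)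
    where
    open EdgeDeletion G u (outer u)
    m₁m₂ : Edge G-ab (Nb.mate₁ u) (Nb.mate₂ u)
    m₁m₂ = deleted-edge-intro (Nb.mates-adjacent u) (λ { (m₁≡u , _) → edge⇒≢ (Nb.edge₁ u) (sym m₁≡u) })
                                                   (λ { (m₁≡u′ , _) → Nb.mate₁≢outer u m₁≡u′ })
    unmatchable : ¬ EdgeInPerfectMatching G-ab (Nb.mate₁ u) (Nb.mate₂ u)
    unmatchable (M , (matched , involutive) , Mm₁≡m₂) with deleted-edge-elim (matched u)
    ... | uMu , ¬uu′ , _ with Nb.complete u (M u) uMu
    ...   | inj₁ Mu≡m₁        = edge⇒≢ (Nb.edge₂ u) (trans (sym (involutive u)) (trans (cong M Mu≡m₁) Mm₁≡m₂))
    ...   | inj₂ (inj₁ Mu≡m₂) = edge⇒≢ (Nb.edge₁ u)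
            (trans (sym (involutive u)) (trans (cong M Mu≡m₂) (trans (cong M (sym Mm₁≡m₂)) (involutive _))))
    ...   | inj₂ (inj₂ Mu≡u′) = ¬uu′ (refl , Mu≡u′)

  outer-matched⇒avoids : ∀ {M a b β} → IsPerfectMatching G M → Mates a b → M β ≡ outer β → In₂ β a b → M a ≢ b
  outer-matched⇒avoids _ ab Mβ (inj₁ refl) Ma≡b = proj₂ ab (trans (sym Ma≡b) Mβ)
  outer-matched⇒avoids {M} {a} {b} (_ , involutive) ab Mβ (inj₂ refl) Ma≡b =
    proj₂ (mates-sym ab) (trans (sym (trans (cong M (sym Ma≡b)) (involutive a))) Mβ)

  AvoidingMatching : V G → V G → V G → V G → Set
  AvoidingMatching a b p q = Σ (V G → V G) λ M → IsPerfectMatching G M × M p ≡ q × M a ≢ b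

  -- Keep the third vertex z of the triangle pqz on its outer edge.
  matching-avoiding-same-triangle : ∀ {a b p q} → Mates a b → Mates p q →
    ¬ (p ≡ a × q ≡ b) → ¬ (p ≡ b × q ≡ a) → SameTriangle p a → AvoidingMatching a b p q
  matching-avoiding-same-triangle {a} {b} {p} {q} ab pq ¬pq≡ab ¬pq≡ba pa =
    M , perfect , Mp≡q , avoids (in-triangle pa) (in-triangle (same-triangle-trans pa (inj₂ ab)))
    where
    z : V G
    z = proj₁ (third-mate pq)
    pz : Mates p z
    pz = proj₁ (proj₂ (third-mate pq))
    z≢q : z ≢ q
    z≢q = proj₂ (proj₂ (third-mate pq))
    qz : Mates q z
    qz = mates-trans pq pz (≢-sym z≢q)
    matching : Σ (V G → V G) λ M → IsPerfectMatching G M × M p ≡ q × M z ≡ outer z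
    matching = triangle-edge-matching pq pz (≢-sym z≢q) (≢-sym (mates⇒≢ pz)) z≢q (proj₂ pz) (proj₂ qz)
    M : V G → V G
    M = proj₁ matching
    perfect : IsPerfectMatching G M
    perfect = proj₁ (proj₂ matching)
    Mp≡q : M p ≡ q
    Mp≡q = proj₁ (proj₂ (proj₂ matching))
    Mz≡z′ : M z ≡ outer z
    Mz≡z′ = proj₂ (proj₂ (proj₂ matching))
    in-triangle : ∀ {w} → SameTriangle p w → In₃ w p q z
    in-triangle (inj₁ refl) = inj₁ refl
    in-triangle (inj₂ pw)   = inj₂ (mates-exhausted pq pz (≢-sym z≢q) pw)
    z-outer : ∀ {t} → t ≡ z → M t ≡ outer t
    z-outer refl = Mz≡z′
    avoids : In₃ a p q z → In₃ b p q z → M a ≢ b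
    avoids (inj₂ (inj₂ a≡z)) _                 = outer-matched⇒avoids perfect ab (z-outer a≡z) (inj₁ refl)
    avoids _                 (inj₂ (inj₂ b≡z)) = outer-matched⇒avoids perfect ab (z-outer b≡z) (inj₂ refl)
    avoids (inj₁ a≡p)        (inj₁ b≡p)        = λ _ → mates⇒≢ ab (trans a≡p (sym b≡p))
    avoids (inj₁ a≡p)        (inj₂ (inj₁ b≡q)) = λ _ → ¬pq≡ab (sym a≡p , sym b≡q)
    avoids (inj₂ (inj₁ a≡q)) (inj₁ b≡p)        = λ _ → ¬pq≡ba (sym b≡p , sym a≡q)
    avoids (inj₂ (inj₁ a≡q)) (inj₂ (inj₁ b≡q)) = λ _ → mates⇒≢ ab (trans a≡q (sym b≡q))

  -- Otherwise keep a or b on its outer edge; both cannot be outer to p and q.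
  matching-avoiding-other-triangle : ∀ {a b p q} → Mates a b → Mates p q → ¬ SameTriangle p a →
    AvoidingMatching a b p q
  matching-avoiding-other-triangle {a} {b} {p} {q} ab pq ¬pa = choose (not-outer a) (not-outer b)
    where
    NotOuter : V G → Set
    NotOuter w = w ≢ outer p × w ≢ outer q
    not-outer : ∀ w → NotOuter w ⊎ In₂ w (outer p) (outer q)
    not-outer w with w ≟ outer p | w ≟ outer q
    ... | yes w≡p′ | _        = inj₂ (inj₁ w≡p′)
    ... | no _     | yes w≡q′ = inj₂ (inj₂ w≡q′)
    ... | no w≢p′  | no w≢q′  = inj₁ (w≢p′ , w≢q′)
    ¬pb : ¬ SameTriangle p b
    ¬pb pb = ¬pa (same-triangle-trans pb (inj₂ (mates-sym ab)))
    ¬q-triangle : ∀ {β} → ¬ SameTriangle p β → ¬ SameTriangle q β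
    ¬q-triangle ¬pβ qβ = ¬pβ (same-triangle-trans (inj₂ pq) qβ)
    keep-outer : ∀ β → In₂ β a b → ¬ SameTriangle p β → NotOuter β → AvoidingMatching a b p q
    keep-outer β β∈ab ¬pβ (β≢p′ , β≢q′) =
      let z , pz , z≢q = third-mate pq
          M , perfect , Mp≡q , Mβ≡β′ = triangle-edge-matching pq pz (≢-sym z≢q)
                                         (λ β≡p → ¬pβ (inj₁ (sym β≡p))) (λ β≡q → ¬q-triangle ¬pβ (inj₁ (sym β≡q)))
                                         β≢p′ β≢q′
      in M , perfect , Mp≡q , outer-matched⇒avoids perfect ab Mβ≡β′ β∈ab
    choose : NotOuter a ⊎ In₂ a (outer p) (outer q) → NotOuter b ⊎ In₂ b (outer p) (outer q) →
      AvoidingMatching a b p q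
    choose (inj₁ a-ok) _ = keep-outer a (inj₁ refl) ¬pa a-ok
    choose (inj₂ _) (inj₁ b-ok) = keep-outer b (inj₂ refl) ¬pb b-ok
    choose (inj₂ (inj₁ a≡p′)) (inj₂ (inj₁ b≡p′)) = ⊥-elim (mates⇒≢ ab (trans a≡p′ (sym b≡p′)))
    choose (inj₂ (inj₁ a≡p′)) (inj₂ (inj₂ b≡q′)) =
      ⊥-elim (no-triangles-joined-twice pq (subst₂ Mates a≡p′ b≡q′ ab))
    choose (inj₂ (inj₂ a≡q′)) (inj₂ (inj₁ b≡p′)) =
      ⊥-elim (no-triangles-joined-twice pq (subst₂ Mates b≡p′ a≡q′ (mates-sym ab)))
    choose (inj₂ (inj₂ a≡q′)) (inj₂ (inj₂ b≡q′)) = ⊥-elim (mates⇒≢ ab (trans a≡q′ (sym b≡q′)))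

  matching-avoiding : ∀ {a b p q} → Mates a b → Mates p q → ¬ (p ≡ a × q ≡ b) → ¬ (p ≡ b × q ≡ a) →
    AvoidingMatching a b p q
  matching-avoiding {a} {b} {p} ab pq ¬pq≡ab ¬pq≡ba with same-triangle? p a
  ... | yes pa = matching-avoiding-same-triangle ab pq ¬pq≡ab ¬pq≡ba pa
  ... | no ¬pa = matching-avoiding-other-triangle ab pq ¬pa

  outer-perfect : IsPerfectMatching G outer
  outer-perfect = outer-edge , outer-involutive

  -- Every vertex reaches the third vertex c of the triangle abc: a along the edge ac, the others
  -- avoiding a, hence the edge ab, by 3-connectivity.
  mates-edge-deleted-connected : ∀ {a b} → Mates a b → Connected (deleteEdge G a b)
  mates-edge-deleted-connected {a} {b} ab s t = Walks._++ʷ_ G-ab (to-c s) (from-c t)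
    where
    open EdgeDeletion G a b
    c : V G
    c = proj₁ (third-mate ab)
    ac : Mates a c
    ac = proj₁ (proj₂ (third-mate ab))
    c≢b : c ≢ b
    c≢b = proj₂ (proj₂ (third-mate ab))
    c≢a : c ≢ a
    c≢a = ≢-sym (mates⇒≢ ac)
    ac′ : Edge G-ab a c
    ac′ = deleted-edge-intro (proj₁ ac) (λ (_ , c≡b) → c≢b c≡b) (λ (a≡b , _) → mates⇒≢ ab a≡b)
    ca′ : Edge G-ab c a
    ca′ = deleted-edge-intro (edge-sym (proj₁ ac)) (λ (c≡a , _) → c≢a c≡a) (λ (c≡b , _) → c≢b c≡b)
    without-a : ∀ {s t} → s ≢ a → t ≢ a → WalkIn G-ab (λ _ → ⊤) s t
    without-a s≢a t≢a = walk-avoiding-a (walk-avoiding-one a s≢a t≢a)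
    to-c : ∀ s → WalkIn G-ab (λ _ → ⊤) s c
    to-c s with s ≟ a
    ... | yes refl = step tt ac′ (here tt)
    ... | no s≢a   = without-a s≢a c≢a
    from-c : ∀ t → WalkIn G-ab (λ _ → ⊤) c t
    from-c t with t ≟ a
    ... | yes refl = step tt ca′ (here tt)
    ... | no t≢a   = without-a c≢a t≢a

  mates-edge-deleted-covered : ∀ {a b} → Mates a b →
    ∀ p q → Edge (deleteEdge G a b) p q → EdgeInPerfectMatching (deleteEdge G a b) p q
  mates-edge-deleted-covered {a} {b} ab p q pq′ = cover (deleted-edge-elim pq′)
    where
    open EdgeDeletion G a b
    cover : Edge G p q × ¬ (p ≡ a × q ≡ b) × ¬ (p ≡ b × q ≡ a) → EdgeInPerfectMatching G-ab p q
    cover (pq , ¬pq≡ab , ¬pq≡ba) with outer-or-mate pq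
    ... | inj₁ q≡p′ = outer , perfect-matching-avoiding outer-perfect (λ a′≡b → proj₂ ab (sym a′≡b)) , sym q≡p′
    ... | inj₂ pq″ with matching-avoiding ab pq″ ¬pq≡ab ¬pq≡ba
    ...   | M , perfect , Mp≡q , Ma≢b = M , perfect-matching-avoiding perfect Ma≢b , Mp≡q

  mates-removable : ∀ {a b} → Mates a b → Removable G a b
  mates-removable ab = proj₁ ab , mates-edge-deleted-connected ab , two≤n , mates-edge-deleted-covered ab
    where
    two≤n : 2 ℕ.≤ n G
    two≤n = ≤-trans (s≤s (s≤s z≤n)) (<⇒≤ (proj₁ connected₃))

  removable⇔in-triangle : ∀ u v → Edge G u v → Removable G u v ⇔ InTriangle G u v
  removable⇔in-triangle u v uv = mk⇔ removable⇒in-triangle (λ t → mates-removable (in-triangle⇒mates t))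
    where
    removable⇒in-triangle : Removable G u v → InTriangle G u v
    removable⇒in-triangle r with outer-or-mate uv
    ... | inj₁ v≡u′ = ⊥-elim (outer-not-removable u (subst (Removable G u) v≡u′ r))
    ... | inj₂ uv′  = mates⇒in-triangle uv′

  opposite : V G → V G × V G
  opposite v = ordered (Nb.mate₁ v) (Nb.mate₂ v)

  opposite-mates : ∀ v → Mates v (proj₁ (opposite v)) × Mates v (proj₂ (opposite v)) ×
                         proj₁ (opposite v) < proj₂ (opposite v)
  opposite-mates v = ordered-spec {P = Mates v} (proj₁ (listed-mates v)) (proj₂ (listed-mates v)) (Nb.mate₁≢mate₂ v)

  -- Both ends of the common opposite edge would have the three mates v, w and each other.
  opposite-injective : ∀ {v w} → opposite v ≡ opposite w → v ≡ w
  opposite-injective {v} {w} eq with v ≟ w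
  ... | yes v≡w = v≡w
  ... | no v≢w  =
    ⊥-elim (mates-at-most-two (mates-sym vp) (mates-sym wp) (mates-trans vp vq p≢q) v≢w (mates⇒≢ vq) (mates⇒≢ wq))
    where
    p q : V G
    p = proj₁ (opposite v)
    q = proj₂ (opposite v)
    vp : Mates v p
    vp = proj₁ (opposite-mates v)
    vq : Mates v q
    vq = proj₁ (proj₂ (opposite-mates v))
    p≢q : p ≢ q
    p≢q = <⇒≢ (proj₂ (proj₂ (opposite-mates v)))
    wp : Mates w p
    wp = subst (Mates w) (sym (cong proj₁ eq)) (proj₁ (opposite-mates w))
    wq : Mates w q
    wq = subst (Mates w) (sym (cong proj₂ eq)) (proj₁ (proj₂ (opposite-mates w)))

  opposite-of-mates : ∀ {z u v} → Mates z u → Mates z v → u < v → opposite z ≡ (u , v)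
  opposite-of-mates {z} {u} {v} zu zv u<v =
    match (mates-exhausted zu zv (<⇒≢ u<v) (proj₁ (opposite-mates z)))
          (mates-exhausted zu zv (<⇒≢ u<v) (proj₁ (proj₂ (opposite-mates z))))
    where
    p<q : proj₁ (opposite z) < proj₂ (opposite z)
    p<q = proj₂ (proj₂ (opposite-mates z))
    match : In₂ (proj₁ (opposite z)) u v → In₂ (proj₂ (opposite z)) u v → opposite z ≡ (u , v)
    match (inj₁ p≡u) (inj₂ q≡v) = cong₂ _,_ p≡u q≡v
    match (inj₁ p≡u) (inj₁ q≡u) = ⊥-elim (<⇒≢ p<q (trans p≡u (sym q≡u)))
    match (inj₂ p≡v) (inj₂ q≡v) = ⊥-elim (<⇒≢ p<q (trans p≡v (sym q≡v)))
    match (inj₂ p≡v) (inj₁ q≡u) = ⊥-elim (<-asym u<v (subst₂ _<_ p≡v q≡u p<q))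

  removable-edges : List (V G × V G)
  removable-edges = tabulate opposite

  removable⇔listed : ∀ u v → u < v → Removable G u v ⇔ (u , v) ∈ removable-edges
  removable⇔listed u v u<v = mk⇔ listed removable
    where
    listed : Removable G u v → (u , v) ∈ removable-edges
    listed r = subst (_∈ removable-edges) (opposite-of-mates (mates-sym uz) zv u<v) (∈-tabulate⁺ z)
      where
      uv : Mates u v
      uv = in-triangle⇒mates (Equivalence.to (removable⇔in-triangle u v (proj₁ r)) r)
      z : V G
      z = proj₁ (third-mate uv)
      uz : Mates u z
      uz = proj₁ (proj₂ (third-mate uv))
      zv : Mates z v
      zv = mates-trans uz uv (proj₂ (proj₂ (third-mate uv)))
    removable : (u , v) ∈ removable-edges → Removable G u v
    removable uv∈ with ∈-tabulate⁻ uv∈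
    ... | i , uv≡opp = mates-removable (mates-trans iu iv (<⇒≢ u<v))
      where
      iu : Mates i u
      iu = subst (Mates i) (sym (cong proj₁ uv≡opp)) (proj₁ (opposite-mates i))
      iv : Mates i v
      iv = subst (Mates i) (sym (cong proj₂ uv≡opp)) (proj₁ (proj₂ (opposite-mates i)))

lemma4p5 : (G : Graph) → Simple G → KConnected 3 G → Cubic G → ClawFree G →
    ¬ Isomorphic G K4 → ¬ Isomorphic G C6bar →
    ((u v : V G) → Edge G u v → (Removable G u v ⇔ InTriangle G u v)) ×
    Σ (List (V G × V G)) (λ L →
      All (λ e → proj₁ e < proj₂ e) L × Unique L ×
      length L ≡ n G ×
      ((u v : V G) → u < v → (Removable G u v ⇔ (u , v) ∈ L)))
lemma4p5 G simple connected₃ cubic claw-free ¬K4 ¬C6bar =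
  removable⇔in-triangle ,
  removable-edges ,
  All-tabulate⁺ (λ v → proj₂ (proj₂ (opposite-mates v))) ,
  Unique-tabulate⁺ opposite-injective ,
  length-tabulate opposite ,
  removable⇔listed
  where open Removability G simple cubic connected₃ claw-free ¬K4 ¬C6bar
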